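{- Let $\ell\ge3$ and let $\tau=\tau_1\tau_2\cdots\tau_\ell\text{ - }\tau_{\ell+1}$ be a vincular pattern of length $\ell+1$ such that $\tau_1\le\tau_2\le\cdots\le\tau_{j-1}<\tau_j>\tau_{j+1}\ge\tau_{j+2}\ge\cdots\ge\tau_\ell$ for some $2\le j\le\ell-1$, and $\tau_j<\tau_{\ell+1}$. Let $\rho=\rho_1\cdots\rho_\ell\text{ - }\rho_{\ell+1}$ be the vincular pattern obtained from $\tau$ by interchanging the letters $\tau_j$ and $\tau_{\ell+1}$ (keeping the dash in the same place). Then $\tau\sim\rho$, and moreover $a_\tau(n,k;a)=a_\rho(n,k;a)$ for all $n\ge1$, $k\ge1$ and $a\in[k]$.
   Context: For $k\ge1$ let $[k]=\{1,\dots,k\}$; a $k$-ary word of length $n$ is an element of $[k]^n$. A pattern is a word $\sigma=\sigma_1\cdots\sigma_m\in[p]^m$ in which every letter of $[p]$ occurs. Two words are order-isomorphic if replacing the $i$-th smallest distinct letter by $i$ yields the same word. A vincular pattern is a pattern with dashes inserted between some consecutive letters; a word $w=w_1\cdots w_n$ contains it if there are indices $i_1<\dots<i_m$ with $w_{i_1}\cdots w_{i_m}$ order-isomorphic to the underlying pattern and $i_{r+1}=i_r+1$ whenever the $r$-th and $(r+1)$-st letters of the pattern are not separated by a dash; otherwise $w$ avoids it. Thus $\tau_1\cdots\tau_\ell\text{ - }\tau_{\ell+1}$ requires the first $\ell$ letters of an occurrence to be consecutive in $w$. $a_\sigma(n,k)$ is the number of words in $[k]^n$ avoiding $\sigma$,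 and $a_\sigma(n,k;a)$ the number of those whose first letter is $a$. $\sigma\sim\tau$ (Wilf-equivalence) means $a_\sigma(n,k)=a_\tau(n,k)$ for all $n\ge0,k\ge1$. -}

module Defs where

open import Data.Nat using (ℕ; zero; suc; _≤_; _<_; _>_; _≥_; _∸_)
open import Data.Fin using (Fin; toℕ; fromℕ; inject₁)
open import Data.Fin.Properties using () renaming (_≟_ to _≟ᶠ_)
open import Data.Vec using (Vec; lookup; head)
open import Data.List using (List; length)
open import Data.List.Membership.Propositional using (_∈_)
open import Data.List.Relation.Unary.Unique.Propositional using (Unique)
open import Data.Product using (Σ; ∃; _×_)
open import Relation.Binary.PropositionalEquality using (_≡_)
open import Relation.Nullary using (¬_; yes; no)
open import Function.Bundles using (_⇔_)

-- A k-ary word of length n is a  Vec (Fin k) n ; the letter  x : Fin k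
-- stands for the element  toℕ x + 1  of [k] (a uniform shift, which does
-- not affect order-isomorphism).  Positions are 0-based internally.

IsPattern : {m : ℕ} → ℕ → (Fin m → ℕ) → Set
IsPattern {m} p σ =
  ((r : Fin m) → (1 ≤ σ r × σ r ≤ p)) ×
  ((c : ℕ) → 1 ≤ c → c ≤ p → ∃ λ (r : Fin m) → σ r ≡ c)

OrderIso : {m : ℕ} → (Fin m → ℕ) → (Fin m → ℕ) → Set
OrderIso {m} u v =
  (r r' : Fin m) → ((u r < u r') ⇔ (v r < v r')) × ((u r ≡ u r') ⇔ (v r ≡ v r'))

-- Occurrence of the vincular pattern σ₁⋯σ_ℓ-σ_{ℓ+1} (letters σ : Fin (suc ℓ) → ℕ,
-- a single dash before the last letter) in a word w of length n:
-- indices f₀ < f₁ < ⋯ < f_ℓ (0-based), where the first ℓ are consecutive,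
-- and  w_{f₀} ⋯ w_{f_ℓ}  is order-isomorphic to σ.
Contains : {ℓ n k : ℕ} → (Fin (suc ℓ) → ℕ) → Vec (Fin k) n → Set
Contains {ℓ} {n} {k} σ w =
  Σ (Fin (suc ℓ) → Fin n) λ f →
    ((r r' : Fin (suc ℓ)) → toℕ r < toℕ r' → toℕ (f r) < toℕ (f r')) ×
    ((r r' : Fin (suc ℓ)) → suc (toℕ r) ≡ toℕ r' → toℕ r' < ℓ →
        toℕ (f r') ≡ suc (toℕ (f r))) ×
    OrderIso (λ r → toℕ (lookup w (f r))) σ

Avoids : {ℓ n k : ℕ} → (Fin (suc ℓ) → ℕ) → Vec (Fin k) n → Set
Avoids σ w = ¬ Contains σ w

-- "the number of words w ∈ [k]^n satisfying P is c":
-- there is a duplicate-free list consisting of exactly those words, of length c.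
CountIs : {n k : ℕ} → (Vec (Fin k) n → Set) → ℕ → Set
CountIs {n} {k} P c =
  Σ (List (Vec (Fin k) n)) λ L →
    Unique L × ((w : Vec (Fin k) n) → (w ∈ L) ⇔ P w) × length L ≡ c

aCount : {ℓ : ℕ} → (Fin (suc ℓ) → ℕ) → (n k c : ℕ) → Set
aCount σ n k c = CountIs {n} {k} (Avoids σ) c

-- a_σ(n,k;a) = c  for n ≥ 1 (words of length suc n with first letter a)
aCountFirst : {ℓ : ℕ} → (Fin (suc ℓ) → ℕ) → (n k : ℕ) → Fin k → ℕ → Set
aCountFirst σ n k a c =
  CountIs {suc n} {k} (λ w → Avoids σ w × head w ≡ a) c

WilfEquiv : {ℓ : ℕ} → (Fin (suc ℓ) → ℕ) → (Fin (suc ℓ) → ℕ) → Set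
WilfEquiv σ τ = (n k : ℕ) → 1 ≤ k → ∃ λ c → aCount σ n k c × aCount τ n k c

lastPos : (ℓ : ℕ) → Fin (suc ℓ)
lastPos ℓ = fromℕ ℓ

swapLast : {ℓ : ℕ} → Fin (suc ℓ) → (Fin (suc ℓ) → ℕ) → (Fin (suc ℓ) → ℕ)
swapLast {ℓ} p τ r with r ≟ᶠ p
... | yes _ = τ (lastPos ℓ)
... | no _ with r ≟ᶠ lastPos ℓ
...   | yes _ = τ p
...   | no _ = τ r

-- Shape hypothesis, with j = toℕ jp + 1 the 1-based peak position:
-- τ₁ ≤ ⋯ ≤ τ_{j-1} < τ_j > τ_{j+1} ≥ ⋯ ≥ τ_ℓ,  2 ≤ j ≤ ℓ-1,  τ_j < τ_{ℓ+1}.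
PeakShape : {ℓ : ℕ} → (Fin (suc ℓ) → ℕ) → Fin (suc ℓ) → Set
PeakShape {ℓ} τ jp =
  (2 ≤ suc (toℕ jp)) × (suc (toℕ jp) ≤ ℓ ∸ 1) ×
  ((r r' : Fin (suc ℓ)) → suc (toℕ r) ≡ toℕ r' → toℕ r' < toℕ jp → τ r ≤ τ r') ×
  ((r : Fin (suc ℓ)) → suc (toℕ r) ≡ toℕ jp → τ r < τ jp) ×
  ((r' : Fin (suc ℓ)) → suc (toℕ jp) ≡ toℕ r' → τ jp > τ r') ×
  ((r r' : Fin (suc ℓ)) → suc (toℕ r) ≡ toℕ r' → toℕ jp < toℕ r → toℕ r' < ℓ →
      τ r ≥ τ r') ×
  (τ jp < τ (lastPos ℓ))

-- A word avoids τ iff, after every occurrence of the consecutive block τ₁⋯τ_ℓ, all later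
-- letters are at most the letter matching τ_j (the peak); it avoids ρ iff every such later
-- letter is at most the largest non-peak letter s of the block or at least the peak.
-- The bijection keeps everything before the peak p of the first occurrence, replaces the
-- peak h by s + k − h, transforms the suffix after p recursively (its letters are ≤ h), and
-- then shifts the letters of that suffix above s up by k − 1 − h, which opens the gap
-- (s, s + k − h) below the new peak.  Since the block rises to its peak and falls after it,
-- no later occurrence has its peak inside the block of the first one, so the recursion
-- leaves that block intact and the construction can be undone step by step.  The first
-- letter is never touched.

module Submission where

open import Defs
open import Data.Nat using (ℕ; suc; _≤_)
open import Data.Fin using (Fin)
open import Data.Product using (∃; _×_)

open import Data.Nat
open import Data.Nat.Properties
open import Data.Fin as F using (toℕ; fromℕ; fromℕ<)
open import Data.Fin.Properties using (toℕ-fromℕ<; toℕ-fromℕ; toℕ-injective; toℕ<n)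
open import Data.Vec as V using (Vec; lookup; head)
open import Data.List using (List; []; _∷_; length; map; filter; cartesianProductWith; allFin)
open import Data.List.Properties using (length-map; map-∘; map-id-local)
open import Data.List.Membership.Propositional using (_∈_)
open import Data.List.Membership.Propositional.Properties
  using (∈-map⁺; ∈-map⁻; ∈-filter⁺; ∈-filter⁻; ∈-cartesianProductWith⁺; ∈-allFin)
open import Data.List.Relation.Unary.All as All using ([])
open import Data.List.Relation.Unary.Any using (here)
open import Data.List.Relation.Unary.AllPairs using ([]; _∷_)
open import Data.List.Relation.Unary.Unique.Propositional using (Unique)
open import Data.List.Relation.Unary.Unique.Propositional.Properties
  using (filter⁺; cartesianProductWith⁺; allFin⁺) renaming (map⁻ to Unique-map⁻)
open import Data.Vec.Properties using (∷-injective)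
open import Data.Product using (_,_; proj₁; proj₂)
open import Data.Sum as Sum using (_⊎_; inj₁; inj₂; [_,_])
open import Data.Empty using (⊥; ⊥-elim)
open import Function using (_∘_)
open import Function.Bundles using (_⇔_; mk⇔; Equivalence)
open import Relation.Nullary using (¬_; Dec; yes; no; map′; _×-dec_; _→-dec_)
open import Relation.Binary.Core using (_Preserves_⟶_)
open import Relation.Binary.Definitions using (tri<; tri≈; tri>)
open import Relation.Binary.PropositionalEquality hiding ([_])

data Least (P : ℕ → Set) (m : ℕ) : Set where
  none  : (∀ i → i < m → ¬ P i) → Least P m
  least : ∀ i → i < m → P i → (∀ i' → i' < i → ¬ P i') → Least P m

least? : {P : ℕ → Set} → (∀ i → Dec (P i)) → ∀ m → Least P m
least? P? zero = none (λ _ ())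
least? P? (suc m) with least? P? m
... | least i i<m pi min = least i (m<n⇒m<1+n i<m) pi min
... | none ¬p with P? m
...   | yes pm = least m (n<1+n m) pm ¬p
...   | no ¬pm = none λ i i<1+m pi →
                   [ (λ i<m → ¬p i i<m pi) , (λ { refl → ¬pm pi }) ] (m<1+n⇒m<n∨m≡n i<1+m)

least-unique : {P : ℕ → Set} {i i' : ℕ} → P i → (∀ k → k < i → ¬ P k) →
               P i' → (∀ k → k < i' → ¬ P k) → i ≡ i'
least-unique {i = i} {i'} p min p' min' with <-cmp i i'
... | tri< i<i' _ _ = ⊥-elim (min' i i<i' p)
... | tri≈ _ i≡i' _ = i≡i'
... | tri> _ _ i>i' = ⊥-elim (min i' i>i' p')

m+n<o⇒n<o∸m : ∀ m {n o} → m + n < o → n < o ∸ m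
m+n<o⇒n<o∸m zero lt = lt
m+n<o⇒n<o∸m (suc m) {o = suc o} (s≤s lt) = m+n<o⇒n<o∸m m lt

n<o∸m⇒m+n<o : ∀ m {n o} → n < o ∸ m → m + n < o
n<o∸m⇒m+n<o zero lt = lt
n<o∸m⇒m+n<o (suc m) {o = suc o} lt = s≤s (n<o∸m⇒m+n<o m lt)

window : (ℕ → ℕ) → ℕ → ℕ → ℕ
window w i r = w (i + r)

_≗[_]_ : (ℕ → ℕ) → ℕ → (ℕ → ℕ) → Set
u ≗[ n ] v = ∀ t → t < n → u t ≡ v t

≗[]-sym : ∀ {u v n} → u ≗[ n ] v → v ≗[ n ] u
≗[]-sym u≗v t t<n = sym (u≗v t t<n)

window-cong : ∀ {u v n} i {m} → i + m ≤ n → u ≗[ n ] v → window u i ≗[ m ] window v i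
window-cong i i+m≤n u≗v r r<m = u≗v (i + r) (<-≤-trans (+-monoʳ-< i r<m) i+m≤n)

suffix-cong : ∀ {u v n} i → u ≗[ n ] v → window u i ≗[ n ∸ i ] window v i
suffix-cong i u≗v d d<n∸i = u≗v (i + d) (n<o∸m⇒m+n<o i d<n∸i)

splice : ℕ → ℕ → (ℕ → ℕ) → (ℕ → ℕ) → ℕ → ℕ
splice p a w u t with <-cmp t p
... | tri< _ _ _ = w t
... | tri≈ _ _ _ = a
... | tri> _ _ _ = u (t ∸ suc p)

module _ {p a : ℕ} {w u : ℕ → ℕ} where

  splice-< : ∀ {t} → t < p → splice p a w u t ≡ w t
  splice-< {t} t<p with <-cmp t p
  ... | tri< _ _ _ = refl
  ... | tri≈ t≮p _ _ = ⊥-elim (t≮p t<p)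
  ... | tri> t≮p _ _ = ⊥-elim (t≮p t<p)

  splice-≡ : splice p a w u p ≡ a
  splice-≡ with <-cmp p p
  ... | tri< _ p≢p _ = ⊥-elim (p≢p refl)
  ... | tri≈ _ _ _ = refl
  ... | tri> _ p≢p _ = ⊥-elim (p≢p refl)

  splice-> : ∀ d → splice p a w u (suc p + d) ≡ u d
  splice-> d with <-cmp (suc p + d) p
  ... | tri< p+d<p _ _ = ⊥-elim (m+n≮m p (suc d) (subst (_< p) (sym (+-suc p d)) p+d<p))
  ... | tri≈ _ p+d≡p _ = ⊥-elim (m+1+n≢m p (trans (+-suc p d) p+d≡p))
  ... | tri> _ _ _ = cong u (m+n∸m≡n (suc p) d)

  splice-elim : (P : ℕ → ℕ → Set) → (∀ t → t < p → P t (w t)) → P p a →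
                (∀ d → P (suc p + d) (u d)) → ∀ t → P t (splice p a w u t)
  splice-elim P P< P≡ P> t with <-cmp t p
  ... | tri< t<p _ _ = P< t t<p
  ... | tri≈ _ refl _ = P≡
  ... | tri> _ _ t>p = subst (λ z → P z (u (t ∸ suc p))) (m+[n∸m]≡n t>p) (P> (t ∸ suc p))

splice-cong : ∀ {p a a' w w' u u'} n → w ≗[ p ] w' → a ≡ a' → (∀ d → suc p + d < n → u d ≡ u' d) →
              splice p a w u ≗[ n ] splice p a' w' u'
splice-cong {p} {a} {a'} {w} {w'} {u} {u'} n w≡ a≡ u≡ =
  splice-elim (λ t x → t < n → x ≡ splice p a' w' u' t)
    (λ t t<p _ → trans (w≡ t t<p) (sym (splice-< t<p)))
    (λ _ → trans a≡ (sym (splice-≡ {p})))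
    (λ d p+d<n → trans (u≡ d p+d<n) (sym (splice-> {p} d)))

maxBelow : (ℕ → ℕ) → ℕ → ℕ
maxBelow g zero = 0
maxBelow g (suc m) = g m ⊔ maxBelow g m

maxBelow-ub : ∀ g {m r} → r < m → g r ≤ maxBelow g m
maxBelow-ub g {suc m} r<1+m with m<1+n⇒m<n∨m≡n r<1+m
... | inj₁ r<m = ≤-trans (maxBelow-ub g r<m) (m≤n⊔m (g m) (maxBelow g m))
... | inj₂ refl = m≤m⊔n (g m) (maxBelow g m)

maxBelow-attained : ∀ g m → ∃ λ r → r < suc m × maxBelow g (suc m) ≡ g r
maxBelow-attained g zero = 0 , z<s , ⊔-identityʳ (g 0)
maxBelow-attained g (suc m) with ⊔-sel (g (suc m)) (maxBelow g (suc m))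
... | inj₁ at-last = suc m , n<1+n (suc m) , at-last
... | inj₂ at-rest with maxBelow-attained g m
...   | r , r<1+m , at-r = r , m<n⇒m<1+n r<1+m , trans at-rest at-r

maxBelow-cong : ∀ {g g'} m → g ≗[ m ] g' → maxBelow g m ≡ maxBelow g' m
maxBelow-cong zero _ = refl
maxBelow-cong (suc m) g≡ = cong₂ _⊔_ (g≡ m (n<1+n m)) (maxBelow-cong m (λ r r<m → g≡ r (m<n⇒m<1+n r<m)))

-- Opening and closing the gap (s, s + c]

strictMono⇒mono : ∀ {f : ℕ → ℕ} → f Preserves _<_ ⟶ _<_ → f Preserves _≤_ ⟶ _≤_
strictMono⇒mono f-mono x≤y with m≤n⇒m<n∨m≡n x≤y
... | inj₁ x<y = <⇒≤ (f-mono x<y)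
... | inj₂ refl = ≤-refl

strictMono-reflects-< : ∀ {f : ℕ → ℕ} → f Preserves _<_ ⟶ _<_ → ∀ {x y} → f x < f y → x < y
strictMono-reflects-< f-mono fx<fy = ≰⇒> λ y≤x → <⇒≱ fx<fy (strictMono⇒mono f-mono y≤x)

strictMono-injective : ∀ {f : ℕ → ℕ} → f Preserves _<_ ⟶ _<_ → ∀ {x y} → f x ≡ f y → x ≡ y
strictMono-injective f-mono {x} {y} fx≡fy with <-cmp x y
... | tri< x<y _ _ = ⊥-elim (<-irrefl fx≡fy (f-mono x<y))
... | tri≈ _ x≡y _ = x≡y
... | tri> _ _ x>y = ⊥-elim (<-irrefl (sym fx≡fy) (f-mono x>y))

raise : ℕ → ℕ → ℕ → ℕ
raise s c x with x ≤? s
... | yes _ = x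
... | no _ = x + c

lower : ℕ → ℕ → ℕ → ℕ
lower s c x with x ≤? s
... | yes _ = x
... | no _ = x ∸ c

OutsideGap : ℕ → ℕ → ℕ → Set
OutsideGap s c x = x ≤ s ⊎ s + suc c ≤ x

module _ {s c : ℕ} where

  raise-≤ : ∀ {x} → x ≤ s → raise s c x ≡ x
  raise-≤ {x} x≤s with x ≤? s
  ... | yes _ = refl
  ... | no x≰s = ⊥-elim (x≰s x≤s)

  raise-> : ∀ {x} → s < x → raise s c x ≡ x + c
  raise-> {x} s<x with x ≤? s
  ... | yes x≤s = ⊥-elim (<⇒≱ s<x x≤s)
  ... | no _ = refl

  lower-≤ : ∀ {x} → x ≤ s → lower s c x ≡ x
  lower-≤ {x} x≤s with x ≤? s
  ... | yes _ = refl
  ... | no x≰s = ⊥-elim (x≰s x≤s)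

  lower-> : ∀ {x} → s < x → lower s c x ≡ x ∸ c
  lower-> {x} s<x with x ≤? s
  ... | yes x≤s = ⊥-elim (<⇒≱ s<x x≤s)
  ... | no _ = refl

  above-gap⇒s< : ∀ {x} → s + suc c ≤ x → s < x
  above-gap⇒s< = <-≤-trans (m<m+n s z<s)

  above-gap⇒c≤ : ∀ {x} → s + suc c ≤ x → c ≤ x
  above-gap⇒c≤ = ≤-trans (≤-trans (n≤1+n c) (m≤n+m (suc c) s))

  raise-strictMono : raise s c Preserves _<_ ⟶ _<_
  raise-strictMono {x} {y} x<y with x ≤? s | y ≤? s
  ... | yes _   | yes _   = x<y
  ... | yes x≤s | no y≰s  = ≤-trans (s≤s x≤s) (≤-trans (≰⇒> y≰s) (m≤m+n y c))
  ... | no x≰s  | yes y≤s = ⊥-elim (x≰s (≤-trans (<⇒≤ x<y) y≤s))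
  ... | no _    | no _    = +-monoˡ-< c x<y

  lower∘raise : ∀ x → lower s c (raise s c x) ≡ x
  lower∘raise x with x ≤? s
  ... | yes x≤s = lower-≤ x≤s
  ... | no x≰s = trans (lower-> (≤-trans (≰⇒> x≰s) (m≤m+n x c))) (m+n∸n≡m x c)

  raise∘lower : ∀ {x} → OutsideGap s c x → raise s c (lower s c x) ≡ x
  raise∘lower (inj₁ x≤s) = trans (cong (raise s c) (lower-≤ x≤s)) (raise-≤ x≤s)
  raise∘lower {x} (inj₂ above) = begin
    raise s c (lower s c x)  ≡⟨ cong (raise s c) (lower-> (above-gap⇒s< above)) ⟩
    raise s c (x ∸ c)        ≡⟨ raise-> s<x∸c ⟩
    x ∸ c + c                ≡⟨ m∸n+n≡m (above-gap⇒c≤ above) ⟩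
    x                        ∎
    where
    open ≡-Reasoning
    s<x∸c : s < x ∸ c
    s<x∸c = m+n≤o⇒m≤o∸n (suc s) (subst (_≤ x) (+-suc s c) above)

  lower-mono : ∀ {x y} → OutsideGap s c x → OutsideGap s c y → x ≤ y →
               lower s c x ≤ lower s c y
  lower-mono x-out y-out x≤y = ≮⇒≥ λ ly<lx →
    <⇒≱ (subst₂ _<_ (raise∘lower y-out) (raise∘lower x-out) (raise-strictMono ly<lx)) x≤y

-- Arithmetic of the reflection h ↦ s + K ∸ h of the interval (s, K)

reflect : ℕ → ℕ → ℕ → ℕ
reflect s K h = s + K ∸ h

module _ {s K h : ℕ} (h<K : h < K) where

  reflect≡ : reflect s K h ≡ suc s + (K ∸ suc h)
  reflect≡ = begin
    s + K ∸ h            ≡⟨ +-∸-assoc s (<⇒≤ h<K) ⟩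
    s + (K ∸ h)          ≡⟨ cong (s +_) (+-∸-assoc 1 h<K) ⟩
    s + suc (K ∸ suc h)  ≡⟨ +-suc s (K ∸ suc h) ⟩
    suc s + (K ∸ suc h)  ∎
    where open ≡-Reasoning

  s<reflect : s < reflect s K h
  s<reflect = subst (s <_) (sym reflect≡) (m≤m+n (suc s) (K ∸ suc h))

  reflect-< : s < h → reflect s K h < K
  reflect-< s<h = begin-strict
    reflect s K h        ≡⟨ reflect≡ ⟩
    suc s + (K ∸ suc h)  ≤⟨ +-monoˡ-≤ (K ∸ suc h) s<h ⟩
    h + (K ∸ suc h)      <⟨ +-monoˡ-< (K ∸ suc h) (n<1+n h) ⟩
    suc h + (K ∸ suc h)  ≡⟨ m+[n∸m]≡n h<K ⟩
    K                    ∎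
    where open ≤-Reasoning

  reflect-involutive : reflect s K (reflect s K h) ≡ h
  reflect-involutive = m∸[m∸n]≡n (≤-trans (<⇒≤ h<K) (m≤n+m K s))

  reflect≤raise : ∀ {x} → s < x → reflect s K h ≤ raise s (K ∸ suc h) x
  reflect≤raise s<x =
    subst₂ _≤_ (sym reflect≡) (sym (raise-> s<x)) (+-monoˡ-≤ (K ∸ suc h) s<x)

  raise-< : s < h → ∀ {x} → x ≤ h → raise s (K ∸ suc h) x < K
  raise-< s<h {x} x≤h with ≤-<-connex x s
  ... | inj₁ x≤s = subst (_< K) (sym (raise-≤ x≤s)) (<-≤-trans (≤-<-trans x≤s s<h) (<⇒≤ h<K))
  ... | inj₂ s<x = subst (_< K) (sym (raise-> s<x)) (begin-strict
    x + (K ∸ suc h)      <⟨ +-monoˡ-< (K ∸ suc h) (s≤s x≤h) ⟩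
    suc h + (K ∸ suc h)  ≡⟨ m+[n∸m]≡n h<K ⟩
    K                    ∎)
    where open ≤-Reasoning

  lower-< : s < h → ∀ {x} → x < K → OutsideGap s (K ∸ suc h) x → lower s (K ∸ suc h) x < suc h
  lower-< s<h x<K (inj₁ x≤s) = subst (_< suc h) (sym (lower-≤ x≤s)) (s≤s (≤-trans x≤s (<⇒≤ s<h)))
  lower-< s<h x<K (inj₂ above) =
    subst₂ _<_ (sym (lower-> (above-gap⇒s< above))) (m∸[m∸n]≡n h<K) (∸-monoˡ-< x<K (above-gap⇒c≤ above))

gap-top : ∀ {s K h} → h < K → s < h → s + suc (K ∸ suc (reflect s K h)) ≡ h
gap-top {s} {K} {h} h<K s<h = begin
  s + suc (K ∸ suc h')   ≡⟨ +-suc s _ ⟩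
  suc s + (K ∸ suc h')   ≡⟨ sym (reflect≡ (reflect-< h<K s<h)) ⟩
  reflect s K h'         ≡⟨ reflect-involutive h<K ⟩
  h                      ∎
  where
  open ≡-Reasoning
  h' : ℕ
  h' = reflect s K h

SameOrder : ℕ → ℕ → ℕ → ℕ → Set
SameOrder x y X Y = ((x < y) ⇔ (X < Y)) × ((x ≡ y) ⇔ (X ≡ Y))

module _ {x y X Y : ℕ} where

  sameOrder-< : x < y → X < Y → SameOrder x y X Y
  sameOrder-< x<y X<Y = mk⇔ (λ _ → X<Y) (λ _ → x<y) ,
                        mk⇔ (λ x≡y → ⊥-elim (<-irrefl x≡y x<y)) (λ X≡Y → ⊥-elim (<-irrefl X≡Y X<Y))

  sameOrder-> : y < x → Y < X → SameOrder x y X Y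
  sameOrder-> y<x Y<X =
    mk⇔ (λ x<y → ⊥-elim (<-asym x<y y<x)) (λ X<Y → ⊥-elim (<-asym X<Y Y<X)) ,
    mk⇔ (λ x≡y → ⊥-elim (<-irrefl (sym x≡y) y<x)) (λ X≡Y → ⊥-elim (<-irrefl (sym X≡Y) Y<X))

  sameOrder⇒< : SameOrder x y X Y → X < Y → x < y
  sameOrder⇒< (<⇔ , _) = Equivalence.from <⇔

  sameOrder⇒≤ : SameOrder x y X Y → X ≤ Y → x ≤ y
  sameOrder⇒≤ (<⇔ , ≡⇔) X≤Y with m≤n⇒m<n∨m≡n X≤Y
  ... | inj₁ X<Y = <⇒≤ (Equivalence.from <⇔ X<Y)
  ... | inj₂ X≡Y = ≤-reflexive (Equivalence.from ≡⇔ X≡Y)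

sameOrder-refl : ∀ {x X} → SameOrder x x X X
sameOrder-refl = mk⇔ (λ x<x → ⊥-elim (<-irrefl refl x<x)) (λ X<X → ⊥-elim (<-irrefl refl X<X)) ,
                 mk⇔ (λ _ → refl) (λ _ → refl)

sameOrder-subst : ∀ {x y X Y x' y' X' Y'} → x ≡ x' → y ≡ y' → X ≡ X' → Y ≡ Y' →
                  SameOrder x y X Y → SameOrder x' y' X' Y'
sameOrder-subst refl refl refl refl so = so

sameOrder? : ∀ x y X Y → Dec (SameOrder x y X Y)
sameOrder? x y X Y = ⇔-dec (x <? y) (X <? Y) ×-dec ⇔-dec (x ≟ y) (X ≟ Y)
  where
  ⇔-dec : ∀ {A B : Set} → Dec A → Dec B → Dec (A ⇔ B)
  ⇔-dec A? B? = map′ (λ (f , g) → mk⇔ f g) (λ A⇔B → Equivalence.to A⇔B , Equivalence.from A⇔B)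
                     ((A? →-dec B?) ×-dec (B? →-dec A?))

module _ {f : ℕ → ℕ} (f-mono : f Preserves _<_ ⟶ _<_) {x y X Y : ℕ} where

  sameOrder-strictMono : SameOrder x y X Y → SameOrder (f x) (f y) X Y
  sameOrder-strictMono (<⇔ , ≡⇔) =
    mk⇔ (Equivalence.to <⇔ ∘ strictMono-reflects-< f-mono) (f-mono ∘ Equivalence.from <⇔) ,
    mk⇔ (Equivalence.to ≡⇔ ∘ strictMono-injective f-mono) (cong f ∘ Equivalence.from ≡⇔)

  sameOrder-strictMono⁻ : SameOrder (f x) (f y) X Y → SameOrder x y X Y
  sameOrder-strictMono⁻ (<⇔ , ≡⇔) =
    mk⇔ (Equivalence.to <⇔ ∘ f-mono) (strictMono-reflects-< f-mono ∘ Equivalence.from <⇔) ,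
    mk⇔ (Equivalence.to ≡⇔ ∘ cong f) (strictMono-injective f-mono ∘ Equivalence.from ≡⇔)

OrderIsoUpTo : ℕ → (ℕ → ℕ) → (ℕ → ℕ) → Set
OrderIsoUpTo m u T = ∀ a b → a < m → b < m → SameOrder (u a) (u b) (T a) (T b)

orderIsoUpTo? : ∀ m u T → Dec (OrderIsoUpTo m u T)
orderIsoUpTo? m u T =
  map′ (λ iso a b a<m b<m → iso a<m b<m) (λ iso {a} a<m {b} b<m → iso a b a<m b<m)
       (allUpTo? (λ a → allUpTo? (λ b → sameOrder? (u a) (u b) (T a) (T b)) m) m)

sameOrder-flip : ∀ {x y X Y} → SameOrder x y X Y → SameOrder y x Y X
sameOrder-flip (<⇔ , ≡⇔) =
  mk⇔ (flip-< <⇔ ≡⇔) (flip-< (⇔-sym <⇔) (⇔-sym ≡⇔)) ,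
  mk⇔ (sym ∘ Equivalence.to ≡⇔ ∘ sym) (sym ∘ Equivalence.from ≡⇔ ∘ sym)
  where
  ⇔-sym : ∀ {A B : Set} → A ⇔ B → B ⇔ A
  ⇔-sym A⇔B = mk⇔ (Equivalence.from A⇔B) (Equivalence.to A⇔B)
  flip-< : ∀ {a b A B} → (a < b) ⇔ (A < B) → (a ≡ b) ⇔ (A ≡ B) → b < a → B < A
  flip-< {a} {b} {A} {B} <⇔' ≡⇔' b<a with <-cmp A B
  ... | tri< A<B _ _ = ⊥-elim (<-asym b<a (Equivalence.from <⇔' A<B))
  ... | tri≈ _ A≡B _ = ⊥-elim (<-irrefl (sym (Equivalence.from ≡⇔' A≡B)) b<a)
  ... | tri> _ _ B<A = B<A

orderIsoUpTo-suc : ∀ {m u T} → OrderIsoUpTo m u T → (∀ a → a < m → SameOrder (u a) (u m) (T a) (T m)) →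
                   OrderIsoUpTo (suc m) u T
orderIsoUpTo-suc {m} iso last a b a<1+m b<1+m with m<1+n⇒m<n∨m≡n a<1+m | m<1+n⇒m<n∨m≡n b<1+m
... | inj₁ a<m | inj₁ b<m = iso a b a<m b<m
... | inj₁ a<m | inj₂ refl = last a a<m
... | inj₂ refl | inj₁ b<m = sameOrder-flip (last b b<m)
... | inj₂ refl | inj₂ refl = sameOrder-refl

orderIsoUpTo-repeak : ∀ {m u u' T T'} p → OrderIsoUpTo m u T →
  (∀ a → a < m → a ≢ p → u a ≡ u' a) → (∀ a → a < m → a ≢ p → T a ≡ T' a) →
  (∀ {a} → a < m → a ≢ p → u' a < u' p) → (∀ {a} → a < m → a ≢ p → T' a < T' p) →
  OrderIsoUpTo m u' T'
orderIsoUpTo-repeak p iso u≡ T≡ u'-max T'-max a b a<m b<m with a ≟ p | b ≟ p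
... | yes refl | yes refl = sameOrder-refl
... | yes refl | no b≢p = sameOrder-> (u'-max b<m b≢p) (T'-max b<m b≢p)
... | no a≢p | yes refl = sameOrder-< (u'-max a<m a≢p) (T'-max a<m a≢p)
... | no a≢p | no b≢p =
  sameOrder-subst (u≡ a a<m a≢p) (u≡ b b<m b≢p) (T≡ a a<m a≢p) (T≡ b b<m b≢p) (iso a b a<m b<m)

allWords : ∀ k m → List (Vec (Fin k) m)
allWords k zero = V.[] ∷ []
allWords k (suc m) = cartesianProductWith V._∷_ (allFin k) (allWords k m)

allWords-unique : ∀ k m → Unique (allWords k m)
allWords-unique k zero = [] ∷ []
allWords-unique k (suc m) = cartesianProductWith⁺ V._∷_ ∷-injective (allFin⁺ k) (allWords-unique k m)

∈-allWords : ∀ {k m} (w : Vec (Fin k) m) → w ∈ allWords k m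
∈-allWords V.[] = here refl
∈-allWords (x V.∷ w) = ∈-cartesianProductWith⁺ V._∷_ (∈-allFin x) (∈-allWords w)

letters : ∀ {k m} → Vec (Fin k) m → ℕ → ℕ
letters V.[] t = 0
letters (x V.∷ w) zero = toℕ x
letters (x V.∷ w) (suc t) = letters w t

letters-lookup : ∀ {k m} (w : Vec (Fin k) m) r → letters w (toℕ r) ≡ toℕ (lookup w r)
letters-lookup (_ V.∷ w) F.zero = refl
letters-lookup (_ V.∷ w) (F.suc r) = letters-lookup w r

letters-< : ∀ {k m} (w : Vec (Fin k) m) {t} → t < m → letters w t < k
letters-< (x V.∷ w) {zero} _ = toℕ<n x
letters-< (x V.∷ w) {suc t} (s≤s t<m) = letters-< w t<m

-- Out-of-range values are sent to 0.
toFin : ∀ {k} → ℕ → Fin (suc k)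
toFin {k} x with x <? suc k
... | yes x<1+k = fromℕ< x<1+k
... | no _ = F.zero

toℕ-toFin : ∀ {k x} → x < suc k → toℕ (toFin {k} x) ≡ x
toℕ-toFin {k} {x} x<1+k with x <? suc k
... | yes x<1+k' = toℕ-fromℕ< x<1+k'
... | no x≮1+k = ⊥-elim (x≮1+k x<1+k)

toFin-toℕ : ∀ {k} (x : Fin (suc k)) → toFin (toℕ x) ≡ x
toFin-toℕ x = toℕ-injective (toℕ-toFin (toℕ<n x))

fromLetters : ∀ {k} → (ℕ → ℕ) → (m : ℕ) → Vec (Fin (suc k)) m
fromLetters g zero = V.[]
fromLetters g (suc m) = toFin (g 0) V.∷ fromLetters (g ∘ suc) m

letters-fromLetters : ∀ {k} g m {t} → t < m → g t < suc k → letters (fromLetters {k} g m) t ≡ g t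
letters-fromLetters g (suc m) {zero} _ g0<1+k = toℕ-toFin g0<1+k
letters-fromLetters g (suc m) {suc t} (s≤s t<m) gt<1+k = letters-fromLetters (g ∘ suc) m t<m gt<1+k

fromLetters-letters : ∀ {k} g m (w : Vec (Fin (suc k)) m) → g ≗[ m ] letters w → fromLetters g m ≡ w
fromLetters-letters g zero V.[] _ = refl
fromLetters-letters g (suc m) (x V.∷ w) g≡ = cong₂ V._∷_
  (toℕ-injective (trans (toℕ-toFin (subst (_< _) (sym (g≡ 0 z<s)) (toℕ<n x))) (g≡ 0 z<s)))
  (fromLetters-letters (g ∘ suc) m w (λ t t<m → g≡ (suc t) (s≤s t<m)))

head-fromLetters : ∀ {k m} (w : Vec (Fin (suc k)) (suc m)) (g : ℕ → ℕ) → g 0 ≡ letters w 0 →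
                   head (fromLetters g (suc m)) ≡ head w
head-fromLetters (x V.∷ w) g g0≡ = trans (cong toFin g0≡) (toFin-toℕ x)

onℕ : ∀ {m} → (Fin m → ℕ) → ℕ → ℕ
onℕ {zero} f r = 0
onℕ {suc m} f zero = f F.zero
onℕ {suc m} f (suc r) = onℕ (f ∘ F.suc) r

onℕ-toℕ : ∀ {m} (f : Fin m → ℕ) r → onℕ f (toℕ r) ≡ f r
onℕ-toℕ f F.zero = refl
onℕ-toℕ f (F.suc r) = onℕ-toℕ (f ∘ F.suc) r

onℕ-fromℕ< : ∀ {m} (f : Fin m → ℕ) {a} (a<m : a < m) → onℕ f a ≡ f (fromℕ< a<m)
onℕ-fromℕ< f a<m = trans (cong (onℕ f) (sym (toℕ-fromℕ< a<m))) (onℕ-toℕ f (fromℕ< a<m))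

countIs-filter : ∀ {n k} {P : Vec (Fin k) n → Set} → (∀ w → Dec (P w)) → ∃ (CountIs P)
countIs-filter {n} {k} {P} P? = length L , L , filter⁺ P? (allWords-unique k n) , L⇔P , refl
  where
  L : List (Vec (Fin k) n)
  L = filter P? (allWords k n)
  L⇔P : ∀ w → w ∈ L ⇔ P w
  L⇔P w = mk⇔ (proj₂ ∘ ∈-filter⁻ P? {xs = allWords k n}) (∈-filter⁺ P? (∈-allWords w))

countIs-transport : ∀ {n k} {P Q : Vec (Fin k) n → Set} (φ ψ : Vec (Fin k) n → Vec (Fin k) n) →
  (∀ {x} → P x → Q (φ x)) → (∀ {y} → Q y → P (ψ y)) →
  (∀ {x} → P x → ψ (φ x) ≡ x) → (∀ {y} → Q y → φ (ψ y) ≡ y) →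
  ∀ {c} → CountIs P c → CountIs Q c
countIs-transport {P = P} {Q} φ ψ φ-Q ψ-P ψφ φψ (L , L-unique , L⇔P , length-L) =
  map φ L , φL-unique , φL⇔Q , trans (length-map φ L) length-L
  where
  ψφL≡L : map ψ (map φ L) ≡ L
  ψφL≡L = trans (sym (map-∘ L)) (map-id-local (All.map ψφ (All.tabulate (Equivalence.to (L⇔P _)))))
  φL-unique : Unique (map φ L)
  φL-unique = Unique-map⁻ (subst Unique (sym ψφL≡L) L-unique)
  φL⇔Q : ∀ w → w ∈ map φ L ⇔ Q w
  φL⇔Q w = mk⇔ to from
    where
    to : w ∈ map φ L → Q w
    to w∈ with ∈-map⁻ φ w∈
    ... | x , x∈L , refl = φ-Q (Equivalence.to (L⇔P x) x∈L)
    from : Q w → w ∈ map φ L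
    from Qw = subst (_∈ map φ L) (φψ Qw) (∈-map⁺ φ (Equivalence.from (L⇔P (ψ w)) (ψ-P Qw)))

-- Windows of length ℓ with a peak at position j

module PeakedWindows (j' e : ℕ) where

  j : ℕ
  j = suc j'

  ℓ : ℕ
  ℓ = suc j + suc e

  j<ℓ : j < ℓ
  j<ℓ = ≤-trans (n<1+n j) (m≤m+n (suc j) (suc e))

  1+j<ℓ : suc j < ℓ
  1+j<ℓ = m<m+n (suc j) z<s

  1+j+d≢j : ∀ d → suc j + d ≢ j
  1+j+d≢j d = ≢-sym (<⇒≢ (≤-trans (n<1+n j) (m≤m+n (suc j) d)))

  offPeak-split : ∀ {r} → r < ℓ → r ≢ j → r < j ⊎ ∃ λ d → r ≡ suc j + d × d < suc e
  offPeak-split {r} r<ℓ r≢j with <-cmp r j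
  ... | tri< r<j _ _ = inj₁ r<j
  ... | tri≈ _ r≡j _ = ⊥-elim (r≢j r≡j)
  ... | tri> _ _ r>j = inj₂ (r ∸ suc j , sym (m+[n∸m]≡n r>j) ,
                             +-cancelˡ-< (suc j) _ _ (subst (_< ℓ) (sym (m+[n∸m]≡n r>j)) r<ℓ))

  ≤peak : ∀ {u : ℕ → ℕ} → (∀ {a} → a < ℓ → a ≢ j → u a < u j) → ∀ {a} → a < ℓ → u a ≤ u j
  ≤peak below {a} a<ℓ with a ≟ j
  ... | yes refl = ≤-refl
  ... | no a≢j = <⇒≤ (below a<ℓ a≢j)

  sideMax : (ℕ → ℕ) → ℕ
  sideMax u = maxBelow u j ⊔ maxBelow (window u (suc j)) (suc e)

  sideMax-ub : ∀ u {r} → r < ℓ → r ≢ j → u r ≤ sideMax u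
  sideMax-ub u r<ℓ r≢j with offPeak-split r<ℓ r≢j
  ... | inj₁ r<j = ≤-trans (maxBelow-ub u r<j) (m≤m⊔n _ _)
  ... | inj₂ (d , refl , d<1+e) = ≤-trans (maxBelow-ub (window u (suc j)) d<1+e) (m≤n⊔m (maxBelow u j) _)

  sideMax-attained : ∀ u → ∃ λ r → r < ℓ × r ≢ j × sideMax u ≡ u r
  sideMax-attained u with ⊔-sel (maxBelow u j) (maxBelow (window u (suc j)) (suc e))
  ... | inj₁ left with maxBelow-attained u j'
  ...   | r , r<j , at-r = r , <-trans r<j j<ℓ , <⇒≢ r<j , trans left at-r
  sideMax-attained u | inj₂ right with maxBelow-attained (window u (suc j)) e
  ...   | d , d<1+e , at-d = suc j + d , +-monoʳ-< (suc j) d<1+e , 1+j+d≢j d , trans right at-d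

  sideMax-cong : ∀ u u' → (∀ r → r < ℓ → r ≢ j → u r ≡ u' r) → sideMax u ≡ sideMax u'
  sideMax-cong u u' u≡ = cong₂ _⊔_
    (maxBelow-cong j (λ r r<j → u≡ r (<-trans r<j j<ℓ) (<⇒≢ r<j)))
    (maxBelow-cong (suc e) (λ d d<1+e → u≡ (suc j + d) (+-monoʳ-< (suc j) d<1+e) (1+j+d≢j d)))

  UnderSide : (ℕ → ℕ) → ℕ → Set
  UnderSide u x = ∃ λ r → r < ℓ × r ≢ j × x ≤ u r

  underSide⇒≤sideMax : ∀ {u x} → UnderSide u x → x ≤ sideMax u
  underSide⇒≤sideMax {u} (r , r<ℓ , r≢j , x≤ur) = ≤-trans x≤ur (sideMax-ub u r<ℓ r≢j)

  ≤sideMax⇒underSide : ∀ {u x} → x ≤ sideMax u → UnderSide u x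
  ≤sideMax⇒underSide {u} x≤max with sideMax-attained u
  ... | r , r<ℓ , r≢j , max≡ur = r , r<ℓ , r≢j , ≤-trans x≤max (≤-reflexive max≡ur)

  -- Q u states that the first ℓ values of u are order-isomorphic to τ₁⋯τ_ℓ; only the
  -- listed consequences of this are used.
  module Bijection
    (Q : (ℕ → ℕ) → Set)
    (Q? : ∀ u → Dec (Q u))
    (Q-cong : ∀ {u u'} → u ≗[ ℓ ] u' → Q u → Q u')
    (Q-strictMono : ∀ {u f} → f Preserves _<_ ⟶ _<_ → Q u → Q (f ∘ u))
    (Q-strictMono⁻ : ∀ {u f} → f Preserves _<_ ⟶ _<_ → Q (f ∘ u) → Q u)
    (Q-peak : ∀ {u} → Q u → ∀ {r} → r < ℓ → r ≢ j → u r < u j)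
    (Q-repeak : ∀ {u u'} → Q u → (∀ r → r < ℓ → r ≢ j → u r ≡ u' r) →
                (∀ {r} → r < ℓ → r ≢ j → u' r < u' j) → Q u')
    (Q-ascending : ∀ {u} → Q u → ∀ r → suc r < j → u r ≤ u (suc r))
    (Q-descending : ∀ {u} → Q u → ∀ r → j < r → suc r < ℓ → u (suc r) ≤ u r)
    where

    Q-rises : ∀ {u} → Q u → ∀ d → d < j → u d ≤ u (suc d)
    Q-rises q d d<j with m<1+n⇒m<n∨m≡n (s≤s d<j)
    ... | inj₁ 1+d<j = Q-ascending q d 1+d<j
    ... | inj₂ refl = <⇒≤ (Q-peak q (<-trans d<j j<ℓ) (<⇒≢ d<j))

    Q-falls : ∀ {u} → Q u → ∀ d → j ≤ d → suc d < ℓ → u (suc d) ≤ u d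
    Q-falls q d j≤d 1+d<ℓ with m≤n⇒m<n∨m≡n j≤d
    ... | inj₁ j<d = Q-descending q d j<d 1+d<ℓ
    ... | inj₂ refl = <⇒≤ (Q-peak q 1+d<ℓ 1+n≢n)

    sideMax<peak : ∀ {u} → Q u → sideMax u < u j
    sideMax<peak {u} q with sideMax-attained u
    ... | r , r<ℓ , r≢j , max≡ur = ≤-<-trans (≤-reflexive max≡ur) (Q-peak q r<ℓ r≢j)

    -- A window rises up to its peak and falls after it, while the peak exceeds both of its
    -- neighbours; so a peak can lie in another window only at that window's peak.
    peak-offset : ∀ {w a b} → Q (window w a) → Q (window w b) →
                  ∀ d → b + d ≡ a + j → d < ℓ → d ≡ j
    peak-offset {w} {a} {b} qa qb d b+d≡a+j d<ℓ with <-cmp d j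
    ... | tri≈ _ d≡j _ = d≡j
    ... | tri< d<j _ _ =
      ⊥-elim (<⇒≱ right-of-a-peak (subst₂ (λ x y → w x ≤ w y) b+d≡a+j b+1+d≡ (Q-rises qb d d<j)))
      where
      b+1+d≡ : b + suc d ≡ a + suc j
      b+1+d≡ = trans (+-suc b d) (trans (cong suc b+d≡a+j) (sym (+-suc a j)))
      right-of-a-peak : w (a + suc j) < w (a + j)
      right-of-a-peak = Q-peak qa 1+j<ℓ 1+n≢n
    peak-offset {w} {a} {b} qa qb zero _ _ | tri> _ _ ()
    peak-offset {w} {a} {b} qa qb (suc d) b+d≡a+j d<ℓ | tri> _ _ j<1+d =
      ⊥-elim (<⇒≱ left-of-a-peak
        (subst₂ (λ x y → w x ≤ w y) b+d≡a+j b+d≡ (Q-falls qb d (s≤s⁻¹ j<1+d) d<ℓ)))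
      where
      b+d≡ : b + d ≡ a + j'
      b+d≡ = suc-injective (trans (sym (+-suc b d)) (trans b+d≡a+j (+-suc a j')))
      left-of-a-peak : w (a + j') < w (a + j)
      left-of-a-peak = Q-peak qa (<-trans (n<1+n j') j<ℓ) (<⇒≢ (n<1+n j'))

    peaks-isolated : ∀ {w a b} → Q (window w a) → Q (window w b) → b ≤ a + j → a + j < b + ℓ → a ≡ b
    peaks-isolated {w} {a} {b} qa qb b≤a+j a+j<b+ℓ with m≤n⇒∃[o]m+o≡n b≤a+j
    ... | d , b+d≡a+j = sym (+-cancelʳ-≡ j b a (trans (cong (b +_) (sym d≡j)) b+d≡a+j))
      where
      d≡j : d ≡ j
      d≡j = peak-offset {w} qa qb d b+d≡a+j (+-cancelˡ-< b _ _ (subst (_< b + ℓ) (sym b+d≡a+j) a+j<b+ℓ))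

    record Occurs (n : ℕ) (w : ℕ → ℕ) (i : ℕ) : Set where
      constructor _,_
      field
        fits : i + ℓ ≤ n
        shape : Q (window w i)

    occurs? : ∀ n w i → Dec (Occurs n w i)
    occurs? n w i = map′ (λ (fits , shape) → fits , shape) (λ (fits , shape) → fits , shape)
                         ((i + ℓ ≤? n) ×-dec Q? (window w i))

    NoOccurrenceBefore : ℕ → (ℕ → ℕ) → ℕ → Set
    NoOccurrenceBefore n w i = ∀ k → k < i → ¬ Occurs n w k

    occurs⇒peak< : ∀ {n w i} → Occurs n w i → i + j < n
    occurs⇒peak< {i = i} (i+ℓ≤n , _) = <-≤-trans (+-monoʳ-< i j<ℓ) i+ℓ≤n

    occurs⇒< : ∀ {n w i} → Occurs n w i → i < n
    occurs⇒< {i = i} occ = ≤-<-trans (m≤m+n i j) (occurs⇒peak< occ)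

    occurs-cong : ∀ {n w w' i} → w ≗[ n ] w' → Occurs n w i → Occurs n w' i
    occurs-cong {i = i} w≗w' (i+ℓ≤n , q) = i+ℓ≤n , Q-cong (window-cong i i+ℓ≤n w≗w') q

    noOccurrenceBefore-cong : ∀ {n w w' i} → w ≗[ n ] w' → NoOccurrenceBefore n w i → NoOccurrenceBefore n w' i
    noOccurrenceBefore-cong w≗w' none-w k k<i occ = none-w k k<i (occurs-cong (≗[]-sym w≗w') occ)

    -- φ fuel K n w acts on the word w of length n over [0, K); fuel ≥ n bounds the recursion.
    -- At the first occurrence i, with peak p = i + j of height h and side maximum s, φ
    -- reflects the peak to s + K ∸ h, transforms the suffix after p over the alphabet
    -- [0, h] and opens the gap (s, s + K ∸ suc h] in it; ψ undoes these steps in reverse.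
    newPeak : ℕ → (ℕ → ℕ) → ℕ → ℕ
    newPeak K w i = reflect (sideMax (window w i)) K (w (i + j))

    mutual
      φ : ℕ → ℕ → (n : ℕ) → (ℕ → ℕ) → ℕ → ℕ
      φ zero K n w = w
      φ (suc fuel) K n w = φ-on fuel K n w (least? (occurs? n w) n)

      φ-on : ℕ → ℕ → (n : ℕ) → (w : ℕ → ℕ) → Least (Occurs n w) n → ℕ → ℕ
      φ-on fuel K n w (none _) = w
      φ-on fuel K n w (least i _ _ _) = φ-at fuel K n w i

      φ-at : ℕ → ℕ → (n : ℕ) → (ℕ → ℕ) → ℕ → ℕ → ℕ
      φ-at fuel K n w i = splice p (newPeak K w i) w
        (raise (sideMax (window w i)) (K ∸ suc (w p)) ∘ φ fuel (suc (w p)) (n ∸ suc p) (window w (suc p)))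
        where
        p : ℕ
        p = i + j

    mutual
      ψ : ℕ → ℕ → (n : ℕ) → (ℕ → ℕ) → ℕ → ℕ
      ψ zero K n v = v
      ψ (suc fuel) K n v = ψ-on fuel K n v (least? (occurs? n v) n)

      ψ-on : ℕ → ℕ → (n : ℕ) → (v : ℕ → ℕ) → Least (Occurs n v) n → ℕ → ℕ
      ψ-on fuel K n v (none _) = v
      ψ-on fuel K n v (least i _ _ _) = ψ-at fuel K n v i

      ψ-at : ℕ → ℕ → (n : ℕ) → (ℕ → ℕ) → ℕ → ℕ → ℕ
      ψ-at fuel K n v i = splice p h v
        (ψ fuel (suc h) (n ∸ suc p) (lower (sideMax (window v i)) (K ∸ suc h) ∘ window v (suc p)))
        where
        p h : ℕ
        p = i + j
        h = newPeak K v i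

    module _ {fuel K n : ℕ} {w : ℕ → ℕ} where

      φ-at-first : ∀ {i} → Occurs n w i → NoOccurrenceBefore n w i → φ (suc fuel) K n w ≗[ n ] φ-at fuel K n w i
      φ-at-first occ before t _ with least? (occurs? n w) n
      ... | none no-occ = ⊥-elim (no-occ _ (occurs⇒< occ) occ)
      ... | least i' _ occ' before' = cong (λ i → φ-at fuel K n w i t) (least-unique occ' before' occ before)

      ψ-at-first : ∀ {i} → Occurs n w i → NoOccurrenceBefore n w i → ψ (suc fuel) K n w ≗[ n ] ψ-at fuel K n w i
      ψ-at-first occ before t _ with least? (occurs? n w) n
      ... | none no-occ = ⊥-elim (no-occ _ (occurs⇒< occ) occ)
      ... | least i' _ occ' before' = cong (λ i → ψ-at fuel K n w i t) (least-unique occ' before' occ before)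

      φ-no-occurrence : NoOccurrenceBefore n w n → φ (suc fuel) K n w ≗[ n ] w
      φ-no-occurrence no-occ t _ with least? (occurs? n w) n
      ... | none _ = refl
      ... | least i i<n occ _ = ⊥-elim (no-occ i i<n occ)

      ψ-no-occurrence : NoOccurrenceBefore n w n → ψ (suc fuel) K n w ≗[ n ] w
      ψ-no-occurrence no-occ t _ with least? (occurs? n w) n
      ... | none _ = refl
      ... | least i i<n occ _ = ⊥-elim (no-occ i i<n occ)

    φ-unchanged : ∀ fuel K n w t → (∀ i → i + j ≤ t → ¬ Occurs n w i) → φ fuel K n w t ≡ w t
    φ-unchanged zero K n w t _ = refl
    φ-unchanged (suc fuel) K n w t no-occ with least? (occurs? n w) n
    ... | none _ = refl
    ... | least i _ occ _ = splice-< (≰⇒> (λ i+j≤t → no-occ i i+j≤t occ))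

    ψ-unchanged : ∀ fuel K n w t → (∀ i → i + j ≤ t → ¬ Occurs n w i) → ψ fuel K n w t ≡ w t
    ψ-unchanged zero K n w t _ = refl
    ψ-unchanged (suc fuel) K n w t no-occ with least? (occurs? n w) n
    ... | none _ = refl
    ... | least i _ occ _ = splice-< (≰⇒> (λ i+j≤t → no-occ i i+j≤t occ))

    mutual
      φ-cong : ∀ fuel K n {w w'} → w ≗[ n ] w' → φ fuel K n w ≗[ n ] φ fuel K n w'
      φ-cong zero K n w≗w' = w≗w'
      φ-cong (suc fuel) K n {w} {w'} w≗w' t t<n with least? (occurs? n w) n
      ... | none no-occ = trans (w≗w' t t<n)
            (sym (φ-no-occurrence (λ i i<n occ → no-occ i i<n (occurs-cong (≗[]-sym w≗w') occ)) t t<n))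
      ... | least i _ occ before = trans (φ-at-cong fuel K n occ w≗w' t t<n)
            (sym (φ-at-first (occurs-cong w≗w' occ) (noOccurrenceBefore-cong w≗w' before) t t<n))

      φ-at-cong : ∀ fuel K n {w w' i} → Occurs n w i → w ≗[ n ] w' → φ-at fuel K n w i ≗[ n ] φ-at fuel K n w' i
      φ-at-cong fuel K n {w} {w'} {i} occ w≗w' =
        splice-cong n (λ t t<p → w≗w' t (<-trans t<p p<n)) (cong₂ (λ s h → reflect s K h) s≡ h≡) tail≡
        where
        p : ℕ
        p = i + j
        p<n : p < n
        p<n = occurs⇒peak< occ
        s≡ : sideMax (window w i) ≡ sideMax (window w' i)
        s≡ = sideMax-cong _ _ (λ r r<ℓ _ → window-cong i (Occurs.fits occ) w≗w' r r<ℓ)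
        h≡ : w p ≡ w' p
        h≡ = w≗w' p p<n
        tail : (ℕ → ℕ) → ℕ → ℕ
        tail x = raise (sideMax (window x i)) (K ∸ suc (x p)) ∘ φ fuel (suc (x p)) (n ∸ suc p) (window x (suc p))
        tail≡ : ∀ d → suc p + d < n → tail w d ≡ tail w' d
        tail≡ d 1+p+d<n = trans
          (cong₂ (λ s h → raise s (K ∸ suc h) (φ fuel (suc h) (n ∸ suc p) (window w (suc p)) d)) s≡ h≡)
          (cong (raise _ _) (φ-cong fuel _ _ (suffix-cong (suc p) w≗w') d (m+n<o⇒n<o∸m (suc p) 1+p+d<n)))

    mutual
      ψ-cong : ∀ fuel K n {v v'} → v ≗[ n ] v' → ψ fuel K n v ≗[ n ] ψ fuel K n v'
      ψ-cong zero K n v≗v' = v≗v'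
      ψ-cong (suc fuel) K n {v} {v'} v≗v' t t<n with least? (occurs? n v) n
      ... | none no-occ = trans (v≗v' t t<n)
            (sym (ψ-no-occurrence (λ i i<n occ → no-occ i i<n (occurs-cong (≗[]-sym v≗v') occ)) t t<n))
      ... | least i _ occ before = trans (ψ-at-cong fuel K n occ v≗v' t t<n)
            (sym (ψ-at-first (occurs-cong v≗v' occ) (noOccurrenceBefore-cong v≗v' before) t t<n))

      ψ-at-cong : ∀ fuel K n {v v' i} → Occurs n v i → v ≗[ n ] v' → ψ-at fuel K n v i ≗[ n ] ψ-at fuel K n v' i
      ψ-at-cong fuel K n {v} {v'} {i} occ v≗v' =
        splice-cong n (λ t t<p → v≗v' t (<-trans t<p p<n)) h≡ tail≡
        where
        p : ℕ
        p = i + j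
        p<n : p < n
        p<n = occurs⇒peak< occ
        s≡ : sideMax (window v i) ≡ sideMax (window v' i)
        s≡ = sideMax-cong _ _ (λ r r<ℓ _ → window-cong i (Occurs.fits occ) v≗v' r r<ℓ)
        h≡ : newPeak K v i ≡ newPeak K v' i
        h≡ = cong₂ (λ s h → reflect s K h) s≡ (v≗v' p p<n)
        tail : (ℕ → ℕ) → ℕ → ℕ
        tail x = ψ fuel (suc (newPeak K x i)) (n ∸ suc p)
                   (lower (sideMax (window x i)) (K ∸ suc (newPeak K x i)) ∘ window x (suc p))
        tail≡ : ∀ d → suc p + d < n → tail v d ≡ tail v' d
        tail≡ d 1+p+d<n = trans
          (cong₂ (λ s h → ψ fuel (suc h) (n ∸ suc p) (lower s (K ∸ suc h) ∘ window v (suc p)) d) s≡ h≡)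
          (ψ-cong fuel _ _ (λ t t< → cong (lower _ _) (suffix-cong (suc p) v≗v' t t<)) d
                  (m+n<o⇒n<o∸m (suc p) 1+p+d<n))

    no-occurrence⇒¬Q : ∀ {n w} → NoOccurrenceBefore n w n → ∀ i t → i + ℓ ≤ t → t < n → ¬ Q (window w i)
    no-occurrence⇒¬Q no-occ i t i+ℓ≤t t<n q =
      no-occ i (≤-<-trans (≤-trans (m≤m+n i ℓ) i+ℓ≤t) t<n) (≤-trans i+ℓ≤t (<⇒≤ t<n) , q)

    later-occurrence-peak : ∀ {w a b} → Q (window w a) → Q (window w b) → a < b → a + ℓ ≤ b + j
    later-occurrence-peak {w} {a} {b} qa qb a<b = ≮⇒≥ λ b+j<a+ℓ →
      <⇒≢ a<b (sym (peaks-isolated {w} qb qa (≤-trans (<⇒≤ a<b) (m≤m+n b j)) b+j<a+ℓ))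

    no-occurrence-at-peak : ∀ {w a b} → Q (window w a) → Q (window w b) → a < b → b ≤ a + j → ⊥
    no-occurrence-at-peak {w} {a} {b} qa qb a<b b≤a+j =
      <⇒≢ a<b (peaks-isolated {w} qa qb b≤a+j (+-mono-<-≤ a<b (<⇒≤ j<ℓ)))

    occurrence-after-first : ∀ {n w i i₂} → NoOccurrenceBefore n w i → Q (window w i) →
                             i₂ + ℓ ≤ n → Q (window w i₂) → i₂ ≡ i ⊎ i + j < i₂
    occurrence-after-first {n} {w} {i} {i₂} before q i₂+ℓ≤n q₂ with <-cmp i₂ i
    ... | tri< i₂<i _ _ = ⊥-elim (before i₂ i₂<i (i₂+ℓ≤n , q₂))
    ... | tri≈ _ i₂≡i _ = inj₁ i₂≡i
    ... | tri> _ _ i<i₂ with i₂ ≤? i + j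
    ...   | yes i₂≤p = ⊥-elim (no-occurrence-at-peak {w} q q₂ i<i₂ i₂≤p)
    ...   | no i₂≰p = inj₂ (≰⇒> i₂≰p)

    no-earlier-occurrence : ∀ {n v w i} → NoOccurrenceBefore n w i → v ≗[ i + j ] w →
                            Q (window v i) → NoOccurrenceBefore n v i
    no-earlier-occurrence {n} {v} {w} {i} before v≗w q k k<i (k+ℓ≤n , qk) with k + ℓ ≤? i + j
    ... | yes k+ℓ≤p = before k k<i (k+ℓ≤n , Q-cong (window-cong k k+ℓ≤p v≗w) qk)
    ... | no k+ℓ≰p = <⇒≢ k<i (sym (peaks-isolated {v} q qk (≤-trans (<⇒≤ k<i) (m≤m+n i j)) (≰⇒> k+ℓ≰p)))

    Q-suffix : ∀ {w} d i → Q (window (window w d) i) → Q (window w (d + i))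
    Q-suffix {w} d i = Q-cong (λ r _ → cong w (sym (+-assoc d i r)))

    -- Inside the window of an occurrence, the suffix after its peak contains no peak
    -- of a later occurrence, so a recursive call on that suffix leaves it unchanged there.
    suffix-unchanged-inside : ∀ {w i n' g} → Q (window w i) →
      (∀ {k} → Occurs n' g k → Q (window w (suc (i + j) + k))) →
      ∀ d → suc (i + j) + d < i + ℓ → ∀ k → k + j ≤ d → ¬ Occurs n' g k
    suffix-unchanged-inside {w} {i} q lift d inside k k+j≤d occ = <-irrefl refl (begin-strict
      i + ℓ                   ≤⟨ later-occurrence-peak {w} q (lift occ) (m≤n⇒m≤n+o k (s≤s (m≤m+n i j))) ⟩
      suc (i + j) + k + j     ≡⟨ +-assoc (suc (i + j)) k j ⟩
      suc (i + j) + (k + j)   ≤⟨ +-monoʳ-≤ (suc (i + j)) k+j≤d ⟩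
      suc (i + j) + d         <⟨ inside ⟩
      i + ℓ                   ∎)
      where open ≤-Reasoning

    Below : ℕ → ℕ → (ℕ → ℕ) → Set
    Below K n w = ∀ t → t < n → w t < K

    TailsUnderPeak : ℕ → (ℕ → ℕ) → Set
    TailsUnderPeak n w = ∀ i t → i + ℓ ≤ t → t < n → Q (window w i) → w t ≤ w (i + j)

    TailsOffGap : ℕ → (ℕ → ℕ) → Set
    TailsOffGap n w = ∀ i t → i + ℓ ≤ t → t < n → Q (window w i) →
                      UnderSide (window w i) (w t) ⊎ w (i + j) ≤ w t

    tailsUnderPeak? : ∀ n u → Dec (TailsUnderPeak n u)
    tailsUnderPeak? n u = map′
      (λ tails i t i+ℓ≤t t<n → tails (≤-<-trans (≤-trans (m≤m+n i ℓ) i+ℓ≤t) t<n) t<n i+ℓ≤t)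
      (λ tails {i} _ {t} t<n i+ℓ≤t → tails i t i+ℓ≤t t<n)
      (allUpTo? (λ i → allUpTo? (λ t → (i + ℓ ≤? t) →-dec (Q? (window u i) →-dec (u t ≤? u (i + j)))) n) n)

    tailsUnderPeak-cong : ∀ {n u u'} → u ≗[ n ] u' → TailsUnderPeak n u → TailsUnderPeak n u'
    tailsUnderPeak-cong {n} u≗u' tails i t i+ℓ≤t t<n q =
      subst₂ _≤_ (u≗u' t t<n) (u≗u' (i + j) (<-≤-trans (+-monoʳ-< i j<ℓ) i+ℓ≤n))
        (tails i t i+ℓ≤t t<n (Q-cong (window-cong i i+ℓ≤n (≗[]-sym u≗u')) q))
      where
      i+ℓ≤n : i + ℓ ≤ n
      i+ℓ≤n = ≤-trans i+ℓ≤t (<⇒≤ t<n)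

    tailsOffGap-cong : ∀ {n u u'} → u ≗[ n ] u' → TailsOffGap n u → TailsOffGap n u'
    tailsOffGap-cong {n} u≗u' tails i t i+ℓ≤t t<n q =
      Sum.map (λ (r , r<ℓ , r≢j , ut≤) →
                 r , r<ℓ , r≢j , subst₂ _≤_ (u≗u' t t<n) (window-cong i i+ℓ≤n u≗u' r r<ℓ) ut≤)
              (subst₂ _≤_ (u≗u' (i + j) (<-≤-trans (+-monoʳ-< i j<ℓ) i+ℓ≤n)) (u≗u' t t<n))
              (tails i t i+ℓ≤t t<n (Q-cong (window-cong i i+ℓ≤n (≗[]-sym u≗u')) q))
      where
      i+ℓ≤n : i + ℓ ≤ n
      i+ℓ≤n = ≤-trans i+ℓ≤t (<⇒≤ t<n)

    φ-Spec : ℕ → Set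
    φ-Spec fuel = ∀ K n w → n ≤ fuel → Below K n w → TailsUnderPeak n w →
      Below K n (φ fuel K n w) × TailsOffGap n (φ fuel K n w) × ψ fuel K n (φ fuel K n w) ≗[ n ] w

    ψ-Spec : ℕ → Set
    ψ-Spec fuel = ∀ K n v → n ≤ fuel → Below K n v → TailsOffGap n v →
      Below K n (ψ fuel K n v) × TailsUnderPeak n (ψ fuel K n v) × φ fuel K n (ψ fuel K n v) ≗[ n ] v

    i+[1+j+d]≡ : ∀ i d → i + (suc j + d) ≡ suc (i + j) + d
    i+[1+j+d]≡ i d = trans (+-suc i (j + d)) (cong suc (sym (+-assoc i j d)))

    suffix-inside-window : ∀ i d → suc (i + j) + d < i + ℓ → suc j + d < ℓ
    suffix-inside-window i d inside = +-cancelˡ-< i _ _ (subst (_< i + ℓ) (sym (i+[1+j+d]≡ i d)) inside)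

    n∸1+p≤fuel : ∀ {n fuel} p → n ≤ suc fuel → n ∸ suc p ≤ fuel
    n∸1+p≤fuel {n} p n≤1+fuel = ≤-trans (∸-monoʳ-≤ n (s≤s (z≤n {p}))) (∸-monoˡ-≤ 1 n≤1+fuel)

    module φ-Step (fuel K n : ℕ) (w : ℕ → ℕ) (i : ℕ) (IH : φ-Spec fuel) (n≤1+fuel : n ≤ suc fuel)
                  (w<K : Below K n w) (w-ok : TailsUnderPeak n w)
                  (occ : Occurs n w i) (before : NoOccurrenceBefore n w i) where

      p h s c n' : ℕ
      p = i + j
      h = w p
      s = sideMax (window w i)
      c = K ∸ suc h
      n' = n ∸ suc p

      R v : ℕ → ℕ
      R = φ fuel (suc h) n' (window w (suc p))
      v = φ-at fuel K n w i

      q : Q (window w i)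
      q = Occurs.shape occ
      p<n : p < n
      p<n = occurs⇒peak< occ
      s<h : s < h
      s<h = sideMax<peak q
      h<K : h < K
      h<K = w<K p p<n

      suffix<1+h : Below (suc h) n' (window w (suc p))
      suffix<1+h d d<n' with suc p + d <? i + ℓ
      ... | yes inside = <⇒≤ (s≤s (subst (_< h) (cong w (i+[1+j+d]≡ i d))
                           (Q-peak q (suffix-inside-window i d inside) (1+j+d≢j d))))
      ... | no outside = s≤s (w-ok i (suc p + d) (≮⇒≥ outside) (n<o∸m⇒m+n<o (suc p) d<n') q)

      suffix-ok : TailsUnderPeak n' (window w (suc p))
      suffix-ok k t k+ℓ≤t t<n' qk = subst (w (suc p + t) ≤_) (cong w (+-assoc (suc p) k j))
        (w-ok (suc p + k) (suc p + t) (subst (_≤ suc p + t) (sym (+-assoc (suc p) k ℓ)) (+-monoʳ-≤ (suc p) k+ℓ≤t))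
              (n<o∸m⇒m+n<o (suc p) t<n') (Q-suffix {w} (suc p) k qk))

      IH-suffix : Below (suc h) n' R × TailsOffGap n' R × ψ fuel (suc h) n' R ≗[ n' ] window w (suc p)
      IH-suffix = IH (suc h) n' (window w (suc p)) (n∸1+p≤fuel p n≤1+fuel) suffix<1+h suffix-ok

      R<1+h : Below (suc h) n' R
      R<1+h = proj₁ IH-suffix

      R-ok : TailsOffGap n' R
      R-ok = proj₁ (proj₂ IH-suffix)

      ψR≗suffix : ψ fuel (suc h) n' R ≗[ n' ] window w (suc p)
      ψR≗suffix = proj₂ (proj₂ IH-suffix)

      R-inside : ∀ d → suc p + d < i + ℓ → R d ≡ w (suc p + d)
      R-inside d inside = φ-unchanged fuel (suc h) n' (window w (suc p)) d
        (suffix-unchanged-inside {w} q (λ occ₃ → Q-suffix {w} (suc p) _ (Occurs.shape occ₃)) d inside)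

      v-suffix : ∀ d → v (suc p + d) ≡ raise s c (R d)
      v-suffix d = splice-> {p} d

      v-window : ∀ r → r < ℓ → r ≢ j → v (i + r) ≡ w (i + r)
      v-window r r<ℓ r≢j with offPeak-split r<ℓ r≢j
      ... | inj₁ r<j = splice-< (+-monoʳ-< i r<j)
      ... | inj₂ (d , refl , _) = begin
        v (i + (suc j + d))   ≡⟨ cong v (i+[1+j+d]≡ i d) ⟩
        v (suc p + d)         ≡⟨ v-suffix d ⟩
        raise s c (R d)       ≡⟨ cong (raise s c) (R-inside d inside) ⟩
        raise s c (w (suc p + d)) ≡⟨ raise-≤ (subst (_≤ s) (cong w (i+[1+j+d]≡ i d)) (sideMax-ub (window w i) r<ℓ r≢j))
                                   ⟩
        w (suc p + d)         ≡⟨ cong w (sym (i+[1+j+d]≡ i d)) ⟩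
        w (i + (suc j + d))   ∎
        where
        open ≡-Reasoning
        inside : suc p + d < i + ℓ
        inside = subst (_< i + ℓ) (i+[1+j+d]≡ i d) (+-monoʳ-< i r<ℓ)

      v-peak : v p ≡ reflect s K h
      v-peak = splice-≡ {p}

      qv : Q (window v i)
      qv = Q-repeak q (λ r r<ℓ r≢j → sym (v-window r r<ℓ r≢j)) λ r<ℓ r≢j →
        subst₂ _<_ (sym (v-window _ r<ℓ r≢j)) (sym v-peak)
               (≤-<-trans (sideMax-ub (window w i) r<ℓ r≢j) (s<reflect h<K))

      sideMax-v : sideMax (window v i) ≡ s
      sideMax-v = sideMax-cong (window v i) (window w i) v-window

      before-v : NoOccurrenceBefore n v i
      before-v = no-earlier-occurrence {n} {v} {w} before (λ t t<p → splice-< t<p) qv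

      v<K : Below K n v
      v<K = splice-elim (λ t x → t < n → x < K) (λ t _ t<n → w<K t t<n) (λ _ → reflect-< h<K s<h)
              (λ d 1+p+d<n → raise-< h<K s<h (s≤s⁻¹ (R<1+h d (m+n<o⇒n<o∸m (suc p) 1+p+d<n))))

      at-first : ∀ t → i + ℓ ≤ t → t < n → UnderSide (window v i) (v t) ⊎ v p ≤ v t
      at-first t i+ℓ≤t _ with m≤n⇒∃[o]m+o≡n (<-≤-trans (+-monoʳ-< i j<ℓ) i+ℓ≤t)
      ... | d , refl with ≤-<-connex (R d) s
      ...   | inj₁ Rd≤s =
        inj₁ (≤sideMax⇒underSide (subst₂ _≤_ (sym (trans (v-suffix d) (raise-≤ Rd≤s))) (sym sideMax-v) Rd≤s))
      ...   | inj₂ s<Rd = inj₂ (subst₂ _≤_ (sym v-peak) (sym (v-suffix d)) (reflect≤raise h<K s<Rd))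

      after-peak : ∀ i₂ t → p < i₂ → i₂ + ℓ ≤ t → t < n → Q (window v i₂) →
                   UnderSide (window v i₂) (v t) ⊎ v (i₂ + j) ≤ v t
      after-peak i₂ t p<i₂ i₂+ℓ≤t t<n q₂
        with m≤n⇒∃[o]m+o≡n p<i₂ | m≤n⇒∃[o]m+o≡n (<-≤-trans p<i₂ (≤-trans (m≤m+n i₂ ℓ) i₂+ℓ≤t))
      ... | k , refl | d , refl =
        Sum.map (λ (r , r<ℓ , r≢j , Rd≤) →
                   r , r<ℓ , r≢j , subst₂ _≤_ (sym (v-suffix d)) (sym (v-R r)) (raise-mono Rd≤))
                (λ R≤Rd → subst₂ _≤_ (sym (v-R j)) (sym (v-suffix d)) (raise-mono R≤Rd))
                (R-ok k d (+-cancelˡ-≤ (suc p) _ _ (subst (_≤ suc p + d) (+-assoc (suc p) k ℓ) i₂+ℓ≤t))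
                      (m+n<o⇒n<o∸m (suc p) t<n) (Q-strictMono⁻ raise-strictMono (Q-cong (λ r _ → v-R r) q₂)))
        where
        raise-mono : raise s c Preserves _≤_ ⟶ _≤_
        raise-mono = strictMono⇒mono (raise-strictMono {s} {c})
        v-R : ∀ r → v (suc p + k + r) ≡ raise s c (R (k + r))
        v-R r = trans (cong v (+-assoc (suc p) k r)) (v-suffix (k + r))

      v-ok : TailsOffGap n v
      v-ok i₂ t i₂+ℓ≤t t<n q₂
        with occurrence-after-first {w = v} before-v qv (≤-trans i₂+ℓ≤t (<⇒≤ t<n)) q₂
      ... | inj₁ refl = at-first t i₂+ℓ≤t t<n
      ... | inj₂ p<i₂ = after-peak i₂ t p<i₂ i₂+ℓ≤t t<n q₂

      newPeak-v : newPeak K v i ≡ h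
      newPeak-v = trans (cong₂ (λ s' h' → reflect s' K h') sideMax-v v-peak) (reflect-involutive h<K)

      ψv≗w : ψ (suc fuel) K n v ≗[ n ] w
      ψv≗w t t<n = trans (ψ-at-first (Occurs.fits occ , qv) before-v t t<n)
        (splice-elim (λ t x → t < n → x ≡ w t) (λ t t<p _ → splice-< t<p) (λ _ → newPeak-v) ψ-suffix t t<n)
        where
        ψ-suffix : ∀ d → suc p + d < n →
          ψ fuel (suc (newPeak K v i)) n' (lower (sideMax (window v i)) (K ∸ suc (newPeak K v i)) ∘ window v (suc p)) d
            ≡ w (suc p + d)
        ψ-suffix d 1+p+d<n = begin
          _  ≡⟨ cong₂ (λ s' h' → ψ fuel (suc h') n' (lower s' (K ∸ suc h') ∘ window v (suc p)) d)
                      sideMax-v newPeak-v ⟩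
          ψ fuel (suc h) n' (lower s c ∘ window v (suc p)) d
             ≡⟨ ψ-cong fuel (suc h) n' (λ t _ → trans (cong (lower s c) (v-suffix t)) (lower∘raise (R t))) d d<n' ⟩
          ψ fuel (suc h) n' R d  ≡⟨ ψR≗suffix d d<n' ⟩
          w (suc p + d)          ∎
          where
          open ≡-Reasoning
          d<n' : d < n'
          d<n' = m+n<o⇒n<o∸m (suc p) 1+p+d<n

    module ψ-Step (fuel K n : ℕ) (v : ℕ → ℕ) (i : ℕ) (IH : ψ-Spec fuel) (n≤1+fuel : n ≤ suc fuel)
                  (v<K : Below K n v) (v-ok : TailsOffGap n v)
                  (occ : Occurs n v i) (before : NoOccurrenceBefore n v i) where

      p s h c n' : ℕ
      p = i + j
      s = sideMax (window v i)
      h = newPeak K v i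
      c = K ∸ suc h
      n' = n ∸ suc p

      g R u : ℕ → ℕ
      g = lower s c ∘ window v (suc p)
      R = ψ fuel (suc h) n' g
      u = ψ-at fuel K n v i

      q : Q (window v i)
      q = Occurs.shape occ
      p<n : p < n
      p<n = occurs⇒peak< occ
      s<vp : s < v p
      s<vp = sideMax<peak q
      vp<K : v p < K
      vp<K = v<K p p<n
      s<h : s < h
      s<h = s<reflect vp<K
      h<K : h < K
      h<K = reflect-< vp<K s<vp

      suffix-inside≤s : ∀ d → suc p + d < i + ℓ → v (suc p + d) ≤ s
      suffix-inside≤s d inside = subst (_≤ s) (cong v (i+[1+j+d]≡ i d))
        (sideMax-ub (window v i) (suffix-inside-window i d inside) (1+j+d≢j d))

      suffix-outside-gap : ∀ d → d < n' → OutsideGap s c (v (suc p + d))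
      suffix-outside-gap d d<n' with suc p + d <? i + ℓ
      ... | yes inside = inj₁ (suffix-inside≤s d inside)
      ... | no outside = Sum.map underSide⇒≤sideMax (subst (_≤ v (suc p + d)) (sym (gap-top vp<K s<vp)))
                           (v-ok i (suc p + d) (≮⇒≥ outside) (n<o∸m⇒m+n<o (suc p) d<n') q)

      raise-g : ∀ d → d < n' → raise s c (g d) ≡ v (suc p + d)
      raise-g d d<n' = raise∘lower (suffix-outside-gap d d<n')

      g<1+h : Below (suc h) n' g
      g<1+h d d<n' = lower-< h<K s<h (v<K _ (n<o∸m⇒m+n<o (suc p) d<n')) (suffix-outside-gap d d<n')

      lift : ∀ {k} → k + ℓ ≤ n' → Q (window g k) → Q (window v (suc p + k))
      lift {k} k+ℓ≤n' qk = Q-cong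
        (λ r r<ℓ → trans (raise-g (k + r) (<-≤-trans (+-monoʳ-< k r<ℓ) k+ℓ≤n'))
                         (cong v (sym (+-assoc (suc p) k r))))
        (Q-strictMono raise-strictMono qk)

      g-ok : TailsOffGap n' g
      g-ok k t k+ℓ≤t t<n' qk =
        Sum.map (λ (r , r<ℓ , r≢j , vt≤) → r , r<ℓ , r≢j ,
                   lower-mono (suffix-outside-gap t t<n') (suffix-outside-gap (k + r) (in-range r<ℓ))
                              (subst (v (suc p + t) ≤_) (cong v (+-assoc (suc p) k r)) vt≤))
                (λ vp≤vt → lower-mono (suffix-outside-gap (k + j) (in-range j<ℓ)) (suffix-outside-gap t t<n')
                              (subst (_≤ v (suc p + t)) (cong v (+-assoc (suc p) k j)) vp≤vt))
                (v-ok (suc p + k) (suc p + t)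
                      (subst (_≤ suc p + t) (sym (+-assoc (suc p) k ℓ)) (+-monoʳ-≤ (suc p) k+ℓ≤t))
                      (n<o∸m⇒m+n<o (suc p) t<n') (lift (≤-trans k+ℓ≤t (<⇒≤ t<n')) qk))
        where
        in-range : ∀ {r} → r < ℓ → k + r < n'
        in-range r<ℓ = <-trans (<-≤-trans (+-monoʳ-< k r<ℓ) k+ℓ≤t) t<n'

      IH-suffix : Below (suc h) n' R × TailsUnderPeak n' R × φ fuel (suc h) n' R ≗[ n' ] g
      IH-suffix = IH (suc h) n' g (n∸1+p≤fuel p n≤1+fuel) g<1+h g-ok

      R<1+h : Below (suc h) n' R
      R<1+h = proj₁ IH-suffix

      R-ok : TailsUnderPeak n' R
      R-ok = proj₁ (proj₂ IH-suffix)

      φR≗g : φ fuel (suc h) n' R ≗[ n' ] g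
      φR≗g = proj₂ (proj₂ IH-suffix)

      R-inside : ∀ d → suc p + d < i + ℓ → R d ≡ v (suc p + d)
      R-inside d inside = trans
        (ψ-unchanged fuel (suc h) n' g d
          (suffix-unchanged-inside {v} q (λ occ₃ → lift (Occurs.fits occ₃) (Occurs.shape occ₃)) d inside))
        (lower-≤ (suffix-inside≤s d inside))

      u-suffix : ∀ d → u (suc p + d) ≡ R d
      u-suffix d = splice-> {p} d

      u-peak : u p ≡ h
      u-peak = splice-≡ {p}

      u-window : ∀ r → r < ℓ → r ≢ j → u (i + r) ≡ v (i + r)
      u-window r r<ℓ r≢j with offPeak-split r<ℓ r≢j
      ... | inj₁ r<j = splice-< (+-monoʳ-< i r<j)
      ... | inj₂ (d , refl , _) = begin
        u (i + (suc j + d))   ≡⟨ cong u (i+[1+j+d]≡ i d) ⟩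
        u (suc p + d)         ≡⟨ u-suffix d ⟩
        R d                   ≡⟨ R-inside d (subst (_< i + ℓ) (i+[1+j+d]≡ i d) (+-monoʳ-< i r<ℓ)) ⟩
        v (suc p + d)         ≡⟨ cong v (sym (i+[1+j+d]≡ i d)) ⟩
        v (i + (suc j + d))   ∎
        where open ≡-Reasoning

      qu : Q (window u i)
      qu = Q-repeak q (λ r r<ℓ r≢j → sym (u-window r r<ℓ r≢j)) λ r<ℓ r≢j →
        subst₂ _<_ (sym (u-window _ r<ℓ r≢j)) (sym u-peak) (≤-<-trans (sideMax-ub (window v i) r<ℓ r≢j) s<h)

      sideMax-u : sideMax (window u i) ≡ s
      sideMax-u = sideMax-cong (window u i) (window v i) u-window

      before-u : NoOccurrenceBefore n u i
      before-u = no-earlier-occurrence {n} {u} {v} before (λ t t<p → splice-< t<p) qu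

      u<K : Below K n u
      u<K = splice-elim (λ t x → t < n → x < K) (λ t _ t<n → v<K t t<n) (λ _ → h<K)
              (λ d 1+p+d<n → <-≤-trans (R<1+h d (m+n<o⇒n<o∸m (suc p) 1+p+d<n)) h<K)

      after-peak : ∀ i₂ t → p < i₂ → i₂ + ℓ ≤ t → t < n → Q (window u i₂) → u t ≤ u (i₂ + j)
      after-peak i₂ t p<i₂ i₂+ℓ≤t t<n q₂
        with m≤n⇒∃[o]m+o≡n p<i₂ | m≤n⇒∃[o]m+o≡n (<-≤-trans p<i₂ (≤-trans (m≤m+n i₂ ℓ) i₂+ℓ≤t))
      ... | k , refl | d , refl = subst₂ _≤_ (sym (u-suffix d)) (sym (u-R j))
        (R-ok k d (+-cancelˡ-≤ (suc p) _ _ (subst (_≤ suc p + d) (+-assoc (suc p) k ℓ) i₂+ℓ≤t))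
              (m+n<o⇒n<o∸m (suc p) t<n) (Q-cong (λ r _ → u-R r) q₂))
        where
        u-R : ∀ r → u (suc p + k + r) ≡ R (k + r)
        u-R r = trans (cong u (+-assoc (suc p) k r)) (u-suffix (k + r))

      u-ok : TailsUnderPeak n u
      u-ok i₂ t i₂+ℓ≤t t<n q₂
        with occurrence-after-first {w = u} before-u qu (≤-trans i₂+ℓ≤t (<⇒≤ t<n)) q₂
      ... | inj₂ p<i₂ = after-peak i₂ t p<i₂ i₂+ℓ≤t t<n q₂
      ... | inj₁ refl with m≤n⇒∃[o]m+o≡n (<-≤-trans (+-monoʳ-< i j<ℓ) i₂+ℓ≤t)
      ...   | d , refl = subst₂ _≤_ (sym (u-suffix d)) (sym u-peak) (s≤s⁻¹ (R<1+h d (m+n<o⇒n<o∸m (suc p) t<n)))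

      newPeak-u : newPeak K u i ≡ v p
      newPeak-u = trans (cong₂ (λ s' h' → reflect s' K h') sideMax-u u-peak) (reflect-involutive vp<K)

      φu≗v : φ (suc fuel) K n u ≗[ n ] v
      φu≗v t t<n = trans (φ-at-first (Occurs.fits occ , qu) before-u t t<n)
        (splice-elim (λ t x → t < n → x ≡ v t) (λ t t<p _ → splice-< t<p) (λ _ → newPeak-u) φ-suffix t t<n)
        where
        φ-suffix : ∀ d → suc p + d < n →
          raise (sideMax (window u i)) (K ∸ suc (u p)) (φ fuel (suc (u p)) n' (window u (suc p)) d) ≡ v (suc p + d)
        φ-suffix d 1+p+d<n = begin
          _  ≡⟨ cong₂ (λ s' h' → raise s' (K ∸ suc h') (φ fuel (suc h') n' (window u (suc p)) d))
                      sideMax-u u-peak ⟩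
          raise s c (φ fuel (suc h) n' (window u (suc p)) d)
             ≡⟨ cong (raise s c) (φ-cong fuel (suc h) n' (λ t _ → u-suffix t) d d<n') ⟩
          raise s c (φ fuel (suc h) n' R d)  ≡⟨ cong (raise s c) (φR≗g d d<n') ⟩
          raise s c (g d)                    ≡⟨ raise-g d d<n' ⟩
          v (suc p + d)                      ∎
          where
          open ≡-Reasoning
          d<n' : d < n'
          d<n' = m+n<o⇒n<o∸m (suc p) 1+p+d<n

    φ-correct : ∀ fuel → φ-Spec fuel
    φ-correct zero K n w z≤n w<K _ = w<K , (λ _ _ _ ()) , (λ _ ())
    φ-correct (suc fuel) K n w n≤1+fuel w<K w-ok with least? (occurs? n w) n
    ... | none no-occ =
      w<K , (λ i t i+ℓ≤t t<n q → ⊥-elim (no-occurrence⇒¬Q no-occ i t i+ℓ≤t t<n q)) , ψ-no-occurrence no-occ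
    ... | least i _ occ before = v<K , v-ok , ψv≗w
      where open φ-Step fuel K n w i (φ-correct fuel) n≤1+fuel w<K w-ok occ before

    ψ-correct : ∀ fuel → ψ-Spec fuel
    ψ-correct zero K n v z≤n v<K _ = v<K , (λ _ _ _ ()) , (λ _ ())
    ψ-correct (suc fuel) K n v n≤1+fuel v<K v-ok with least? (occurs? n v) n
    ... | none no-occ =
      v<K , (λ i t i+ℓ≤t t<n q → ⊥-elim (no-occurrence⇒¬Q no-occ i t i+ℓ≤t t<n q)) , φ-no-occurrence no-occ
    ... | least i _ occ before = u<K , u-ok , φu≗v
      where open ψ-Step fuel K n v i (ψ-correct fuel) n≤1+fuel v<K v-ok occ before

    φ-head : ∀ fuel K n w → φ fuel K n w 0 ≡ w 0
    φ-head fuel K n w = φ-unchanged fuel K n w 0 (λ i i+j≤0 _ → n≮0 (subst (_≤ 0) (+-suc i j') i+j≤0))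

    ψ-head : ∀ fuel K n v → ψ fuel K n v 0 ≡ v 0
    ψ-head fuel K n v = ψ-unchanged fuel K n v 0 (λ i i+j≤0 _ → n≮0 (subst (_≤ 0) (+-suc i j') i+j≤0))

-- Occurrences of a vincular pattern with ℓ consecutive letters and a last, free letter

module VincularOccurrences (L : ℕ) where

  ℓ : ℕ
  ℓ = suc L

  position : ℕ → ℕ → ℕ → ℕ
  position i t a with a <? ℓ
  ... | yes _ = i + a
  ... | no _ = t

  position-< : ∀ {i t a} → a < ℓ → position i t a ≡ i + a
  position-< {a = a} a<ℓ with a <? ℓ
  ... | yes _ = refl
  ... | no a≮ℓ = ⊥-elim (a≮ℓ a<ℓ)

  position-ℓ : ∀ {i t} → position i t ℓ ≡ t
  position-ℓ with ℓ <? ℓ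
  ... | yes ℓ<ℓ = ⊥-elim (<-irrefl refl ℓ<ℓ)
  ... | no _ = refl

  OccursAt : ∀ {k n} → (Fin (suc ℓ) → ℕ) → Vec (Fin k) n → ℕ → ℕ → Set
  OccursAt σ w i t = OrderIsoUpTo (suc ℓ) (letters w ∘ position i t) (onℕ σ)

  module _ {k n : ℕ} (σ : Fin (suc ℓ) → ℕ) (w : Vec (Fin k) n) where

    contains⇒occursAt : Contains σ w → ∃ λ i → ∃ λ t → i + ℓ ≤ t × t < n × OccursAt σ w i t
    contains⇒occursAt (f , f-mono , f-consecutive , f-iso) = F 0 , F ℓ , i+ℓ≤t , t<n , occurs
      where
      F : ℕ → ℕ
      F = onℕ (toℕ ∘ f)
      F≡ : ∀ {a} (a<1+ℓ : a < suc ℓ) → F a ≡ toℕ (f (fromℕ< a<1+ℓ))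
      F≡ = onℕ-fromℕ< (toℕ ∘ f)
      F-block : ∀ {a} → a < ℓ → F a ≡ F 0 + a
      F-block {zero} _ = sym (+-identityʳ (F 0))
      F-block {suc a} 1+a<ℓ = begin
        F (suc a)                        ≡⟨ F≡ (m<n⇒m<1+n 1+a<ℓ) ⟩
        toℕ (f (fromℕ< (m<n⇒m<1+n 1+a<ℓ))) ≡⟨ f-consecutive _ _
                                               (trans (cong suc (toℕ-fromℕ< a<1+ℓ)) (sym (toℕ-fromℕ< (m<n⇒m<1+n 1+a<ℓ))))
                                               (subst (_< ℓ) (sym (toℕ-fromℕ< (m<n⇒m<1+n 1+a<ℓ))) 1+a<ℓ) ⟩
        suc (toℕ (f (fromℕ< a<1+ℓ)))     ≡⟨ cong suc (sym (F≡ a<1+ℓ)) ⟩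
        suc (F a)                        ≡⟨ cong suc (F-block (<-trans (n<1+n a) 1+a<ℓ)) ⟩
        suc (F 0 + a)                    ≡⟨ sym (+-suc (F 0) a) ⟩
        F 0 + suc a                      ∎
        where
        open ≡-Reasoning
        a<1+ℓ : a < suc ℓ
        a<1+ℓ = <-trans (n<1+n a) (m<n⇒m<1+n 1+a<ℓ)
      i+ℓ≤t : F 0 + ℓ ≤ F ℓ
      i+ℓ≤t = subst (_≤ F ℓ) (trans (cong suc (F-block (n<1+n L))) (sym (+-suc (F 0) L)))
        (subst₂ _<_ (sym (F≡ (m<n⇒m<1+n (n<1+n L)))) (sym (F≡ (n<1+n ℓ)))
          (f-mono _ _ (subst₂ _<_ (sym (toℕ-fromℕ< (m<n⇒m<1+n (n<1+n L)))) (sym (toℕ-fromℕ< (n<1+n ℓ))) (n<1+n L))))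
      t<n : F ℓ < n
      t<n = subst (_< n) (sym (F≡ (n<1+n ℓ))) (toℕ<n _)
      position≡F : ∀ {a} → a < suc ℓ → position (F 0) (F ℓ) a ≡ F a
      position≡F a<1+ℓ with m<1+n⇒m<n∨m≡n a<1+ℓ
      ... | inj₁ a<ℓ = trans (position-< a<ℓ) (sym (F-block a<ℓ))
      ... | inj₂ refl = position-ℓ
      letter≡ : ∀ {a} (a<1+ℓ : a < suc ℓ) → letters w (position (F 0) (F ℓ) a) ≡ toℕ (lookup w (f (fromℕ< a<1+ℓ)))
      letter≡ a<1+ℓ = trans (cong (letters w) (trans (position≡F a<1+ℓ) (F≡ a<1+ℓ))) (letters-lookup w _)
      occurs : OccursAt σ w (F 0) (F ℓ)
      occurs a b a<1+ℓ b<1+ℓ = sameOrder-subst (sym (letter≡ a<1+ℓ)) (sym (letter≡ b<1+ℓ))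
        (sym (onℕ-fromℕ< σ a<1+ℓ)) (sym (onℕ-fromℕ< σ b<1+ℓ)) (f-iso (fromℕ< a<1+ℓ) (fromℕ< b<1+ℓ))

    occursAt⇒contains : ∀ {i t} → i + ℓ ≤ t → t < n → OccursAt σ w i t → Contains σ w
    occursAt⇒contains {i} {t} i+ℓ≤t t<n occurs = f , f-mono , f-consecutive , f-iso
      where
      position<n : ∀ {a} → a < suc ℓ → position i t a < n
      position<n a<1+ℓ with m<1+n⇒m<n∨m≡n a<1+ℓ
      ... | inj₁ a<ℓ = subst (_< n) (sym (position-< a<ℓ)) (<-≤-trans (+-monoʳ-< i a<ℓ) (≤-trans i+ℓ≤t (<⇒≤ t<n)))
      ... | inj₂ refl = subst (_< n) (sym position-ℓ) t<n
      f : Fin (suc ℓ) → Fin n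
      f r = fromℕ< (position<n (toℕ<n r))
      toℕ-f : ∀ r → toℕ (f r) ≡ position i t (toℕ r)
      toℕ-f r = toℕ-fromℕ< _
      f-mono : ∀ r r' → toℕ r < toℕ r' → toℕ (f r) < toℕ (f r')
      f-mono r r' r<r' with m<1+n⇒m<n∨m≡n (toℕ<n r')
      ... | inj₁ r'<ℓ = subst₂ _<_ (sym (trans (toℕ-f r) (position-< r<ℓ))) (sym (trans (toℕ-f r') (position-< r'<ℓ)))
                          (+-monoʳ-< i r<r')
        where
        r<ℓ : toℕ r < ℓ
        r<ℓ = <-trans r<r' r'<ℓ
      ... | inj₂ r'≡ℓ = subst₂ _<_ (sym (trans (toℕ-f r) (position-< r<ℓ))) (sym (trans (toℕ-f r') (trans (cong (position i t) r'≡ℓ) position-ℓ)))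
                          (<-≤-trans (+-monoʳ-< i r<ℓ) i+ℓ≤t)
        where
        r<ℓ : toℕ r < ℓ
        r<ℓ = subst (toℕ r <_) r'≡ℓ r<r'
      f-consecutive : ∀ r r' → suc (toℕ r) ≡ toℕ r' → toℕ r' < ℓ → toℕ (f r') ≡ suc (toℕ (f r))
      f-consecutive r r' 1+r≡r' r'<ℓ = begin
        toℕ (f r')              ≡⟨ trans (toℕ-f r') (position-< r'<ℓ) ⟩
        i + toℕ r'              ≡⟨ cong (i +_) (sym 1+r≡r') ⟩
        i + suc (toℕ r)         ≡⟨ +-suc i (toℕ r) ⟩
        suc (i + toℕ r)         ≡⟨ cong suc (sym (trans (toℕ-f r) (position-< r<ℓ))) ⟩
        suc (toℕ (f r))         ∎
        where
        open ≡-Reasoning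
        r<ℓ : toℕ r < ℓ
        r<ℓ = <-trans (subst (toℕ r <_) 1+r≡r' (n<1+n (toℕ r))) r'<ℓ
      letter≡ : ∀ r → toℕ (lookup w (f r)) ≡ letters w (position i t (toℕ r))
      letter≡ r = trans (sym (letters-lookup w (f r))) (cong (letters w) (toℕ-f r))
      f-iso : OrderIso (λ r → toℕ (lookup w (f r))) σ
      f-iso r r' = sameOrder-subst (sym (letter≡ r)) (sym (letter≡ r')) (onℕ-toℕ σ r) (onℕ-toℕ σ r')
                     (occurs (toℕ r) (toℕ r') (toℕ<n r) (toℕ<n r'))

module _ {ℓ : ℕ} {p : Fin (suc ℓ)} {τ : Fin (suc ℓ) → ℕ} where

  swapLast-at : swapLast p τ p ≡ τ (lastPos ℓ)
  swapLast-at with p F.≟ p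
  ... | yes _ = refl
  ... | no p≢p = ⊥-elim (p≢p refl)

  swapLast-last : p ≢ lastPos ℓ → swapLast p τ (lastPos ℓ) ≡ τ p
  swapLast-last p≢last with lastPos ℓ F.≟ p
  ... | yes last≡p = ⊥-elim (p≢last (sym last≡p))
  ... | no _ with lastPos ℓ F.≟ lastPos ℓ
  ...   | yes _ = refl
  ...   | no last≢last = ⊥-elim (last≢last refl)

  swapLast-other : ∀ {x} → x ≢ p → x ≢ lastPos ℓ → swapLast p τ x ≡ τ x
  swapLast-other {x} x≢p x≢last with x F.≟ p
  ... | yes x≡p = ⊥-elim (x≢p x≡p)
  ... | no _ with x F.≟ lastPos ℓ
  ...   | yes x≡last = ⊥-elim (x≢last x≡last)
  ...   | no _ = refl

module PeakPattern (j' e : ℕ) where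

  open PeakedWindows j' e
  open VincularOccurrences (j + suc e) using (position; position-<; position-ℓ; OccursAt;
                                              contains⇒occursAt; occursAt⇒contains)

  module _ (τ : Fin (suc ℓ) → ℕ) (jp : Fin (suc ℓ)) (jp≡j : toℕ jp ≡ j) (shape : PeakShape τ jp) where

    T : ℕ → ℕ
    T = onℕ τ

    <1+ℓ : ∀ {a} → a < ℓ → a < suc ℓ
    <1+ℓ = m<n⇒m<1+n

    T≡ : ∀ {a} (a<1+ℓ : a < suc ℓ) → T a ≡ τ (fromℕ< a<1+ℓ)
    T≡ = onℕ-fromℕ< τ

    T-peak : T j ≡ τ jp
    T-peak = trans (cong T (sym jp≡j)) (onℕ-toℕ τ jp)

    T-last : T ℓ ≡ τ (lastPos ℓ)
    T-last = trans (cong T (sym (toℕ-fromℕ ℓ))) (onℕ-toℕ τ (fromℕ ℓ))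

    toℕ-successive : ∀ {r} (1+r<1+ℓ : suc r < suc ℓ) →
                     suc (toℕ (fromℕ< (<-trans (n<1+n r) 1+r<1+ℓ))) ≡ toℕ (fromℕ< 1+r<1+ℓ)
    toℕ-successive 1+r<1+ℓ = trans (cong suc (toℕ-fromℕ< _)) (sym (toℕ-fromℕ< 1+r<1+ℓ))

    T-ascending : ∀ r → suc r < j → T r ≤ T (suc r)
    T-ascending r 1+r<j = let (_ , _ , ascending , _) = shape in
      subst₂ _≤_ (sym (T≡ (<-trans (n<1+n r) 1+r<))) (sym (T≡ 1+r<))
        (ascending _ _ (toℕ-successive 1+r<) (subst₂ _<_ (sym (toℕ-fromℕ< 1+r<)) (sym jp≡j) 1+r<j))
      where
      1+r< : suc r < suc ℓ
      1+r< = <1+ℓ (<-trans 1+r<j j<ℓ)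

    T-descending : ∀ r → j < r → suc r < ℓ → T (suc r) ≤ T r
    T-descending r j<r 1+r<ℓ = let (_ , _ , _ , _ , _ , descending , _) = shape in
      subst₂ _≤_ (sym (T≡ 1+r<)) (sym (T≡ r<))
        (descending _ _ (toℕ-successive 1+r<) (subst₂ _<_ (sym jp≡j) (sym (toℕ-fromℕ< r<)) j<r)
                    (subst (_< ℓ) (sym (toℕ-fromℕ< 1+r<)) 1+r<ℓ))
      where
      1+r< : suc r < suc ℓ
      1+r< = <1+ℓ 1+r<ℓ
      r< : r < suc ℓ
      r< = <-trans (n<1+n r) 1+r<

    T-left-of-peak : T j' < T j
    T-left-of-peak = let (_ , _ , _ , left , _) = shape in
      subst₂ _<_ (sym (T≡ j'<)) (sym T-peak) (left _ (trans (cong suc (toℕ-fromℕ< j'<)) (sym jp≡j)))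
      where
      j'< : j' < suc ℓ
      j'< = <1+ℓ (<-trans (n<1+n j') j<ℓ)

    T-right-of-peak : T (suc j) < T j
    T-right-of-peak = let (_ , _ , _ , _ , right , _) = shape in
      subst₂ _<_ (sym (T≡ 1+j<)) (sym T-peak) (right _ (trans (cong suc jp≡j) (sym (toℕ-fromℕ< 1+j<))))
      where
      1+j< : suc j < suc ℓ
      1+j< = <1+ℓ 1+j<ℓ

    T-peak<last : T j < T ℓ
    T-peak<last = let (_ , _ , _ , _ , _ , _ , peak<last) = shape in
      subst₂ _<_ (sym T-peak) (sym T-last) peak<last

    T-up-to-left : ∀ d r → r + d ≡ j' → T r ≤ T j'
    T-up-to-left zero r r+0≡j' = ≤-reflexive (cong T (trans (sym (+-identityʳ r)) r+0≡j'))
    T-up-to-left (suc d) r r+1+d≡j' = ≤-trans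
      (T-ascending r (s≤s (subst (suc r ≤_) (trans (sym (+-suc r d)) r+1+d≡j') (s≤s (m≤m+n r d)))))
      (T-up-to-left d (suc r) (trans (sym (+-suc r d)) r+1+d≡j'))

    T-down-from-right : ∀ d → suc j + d < ℓ → T (suc j + d) ≤ T (suc j)
    T-down-from-right zero _ = ≤-reflexive (cong T (+-identityʳ (suc j)))
    T-down-from-right (suc d) 1+j+1+d<ℓ = ≤-trans
      (subst (λ x → T x ≤ T (suc j + d)) (sym (+-suc (suc j) d))
        (T-descending (suc j + d) (≤-trans (n<1+n j) (m≤m+n (suc j) d)) (subst (_< ℓ) (+-suc (suc j) d) 1+j+1+d<ℓ)))
      (T-down-from-right d (<-trans (subst (suc j + d <_) (sym (+-suc (suc j) d)) (n<1+n _)) 1+j+1+d<ℓ))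

    T-below-peak : ∀ {a} → a < ℓ → a ≢ j → T a < T j
    T-below-peak {a} a<ℓ a≢j with offPeak-split a<ℓ a≢j
    ... | inj₁ a<j = ≤-<-trans (T-up-to-left (j' ∸ a) a (m+[n∸m]≡n (s≤s⁻¹ a<j))) T-left-of-peak
    ... | inj₂ (d , refl , _) = ≤-<-trans (T-down-from-right d a<ℓ) T-right-of-peak

    Q : (ℕ → ℕ) → Set
    Q u = OrderIsoUpTo ℓ u T

    Q-peak : ∀ {u} → Q u → ∀ {r} → r < ℓ → r ≢ j → u r < u j
    Q-peak q r<ℓ r≢j = sameOrder⇒< (q _ j r<ℓ j<ℓ) (T-below-peak r<ℓ r≢j)

    open PeakedWindows.Bijection j' e Q
      (λ u → orderIsoUpTo? ℓ u T)
      (λ u≗u' q a b a<ℓ b<ℓ → sameOrder-subst (u≗u' a a<ℓ) (u≗u' b b<ℓ) refl refl (q a b a<ℓ b<ℓ))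
      (λ f-mono q a b a<ℓ b<ℓ → sameOrder-strictMono f-mono (q a b a<ℓ b<ℓ))
      (λ f-mono q a b a<ℓ b<ℓ → sameOrder-strictMono⁻ f-mono (q a b a<ℓ b<ℓ))
      Q-peak
      (λ q u≡u' u'-max → orderIsoUpTo-repeak j q u≡u' (λ _ _ _ → refl) u'-max T-below-peak)
      (λ q r 1+r<j → sameOrder⇒≤ (q r (suc r) (<-trans (<-trans (n<1+n r) 1+r<j) j<ℓ) (<-trans 1+r<j j<ℓ)) (T-ascending r 1+r<j))
      (λ q r j<r 1+r<ℓ → sameOrder⇒≤ (q (suc r) r 1+r<ℓ (<-trans (n<1+n r) 1+r<ℓ)) (T-descending r j<r 1+r<ℓ))
      public

    ρ : Fin (suc ℓ) → ℕ
    ρ = swapLast jp τ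

    S : ℕ → ℕ
    S = onℕ ρ

    jp≢last : jp ≢ lastPos ℓ
    jp≢last jp≡last = <-irrefl (trans (sym jp≡j) (trans (cong toℕ jp≡last) (toℕ-fromℕ ℓ))) j<ℓ

    S-peak : S j ≡ T ℓ
    S-peak = trans (cong S (sym jp≡j)) (trans (onℕ-toℕ ρ jp) (trans (swapLast-at {p = jp} {τ = τ}) (sym T-last)))

    S-last : S ℓ ≡ T j
    S-last = trans (cong S (sym (toℕ-fromℕ ℓ))) (trans (onℕ-toℕ ρ (fromℕ ℓ)) (trans (swapLast-last jp≢last) (sym T-peak)))

    S-other : ∀ {a} → a < ℓ → a ≢ j → S a ≡ T a
    S-other {a} a<ℓ a≢j = trans (onℕ-fromℕ< ρ a<1+ℓ) (trans (swapLast-other ≢jp ≢last) (sym (T≡ a<1+ℓ)))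
      where
      a<1+ℓ : a < suc ℓ
      a<1+ℓ = <1+ℓ a<ℓ
      ≢jp : fromℕ< a<1+ℓ ≢ jp
      ≢jp a≡jp = a≢j (trans (sym (toℕ-fromℕ< a<1+ℓ)) (trans (cong toℕ a≡jp) jp≡j))
      ≢last : fromℕ< a<1+ℓ ≢ lastPos ℓ
      ≢last a≡last = <-irrefl (trans (sym (toℕ-fromℕ< a<1+ℓ)) (trans (cong toℕ a≡last) (toℕ-fromℕ ℓ))) a<ℓ

    S-below-peak : ∀ {a} → a < ℓ → a ≢ j → S a < S j
    S-below-peak a<ℓ a≢j = subst₂ _<_ (sym (S-other a<ℓ a≢j)) (sym S-peak) (<-trans (T-below-peak a<ℓ a≢j) T-peak<last)

    module _ {k n : ℕ} (w : Vec (Fin k) n) {i t : ℕ} where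

      W : ℕ → ℕ
      W = letters w

      letter-< : ∀ {a} → a < ℓ → letters w (position i t a) ≡ W (i + a)
      letter-< a<ℓ = cong W (position-< a<ℓ)

      letter-ℓ : letters w (position i t ℓ) ≡ W t
      letter-ℓ = cong W position-ℓ

      occursAt⇒window : ∀ {σ} → OccursAt σ w i t → OrderIsoUpTo ℓ (window W i) (onℕ σ)
      occursAt⇒window occ a b a<ℓ b<ℓ = sameOrder-subst (letter-< a<ℓ) (letter-< b<ℓ) refl refl
        (occ a b (<1+ℓ a<ℓ) (<1+ℓ b<ℓ))

      window⇒occursAt : ∀ {σ} → OrderIsoUpTo ℓ (window W i) (onℕ σ) →
        (∀ a → a < ℓ → SameOrder (W (i + a)) (W t) (onℕ σ a) (onℕ σ ℓ)) → OccursAt σ w i t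
      window⇒occursAt iso last = orderIsoUpTo-suc
        (λ a b a<ℓ b<ℓ → sameOrder-subst (sym (letter-< a<ℓ)) (sym (letter-< b<ℓ)) refl refl (iso a b a<ℓ b<ℓ))
        (λ a a<ℓ → sameOrder-subst (sym (letter-< a<ℓ)) (sym letter-ℓ) refl refl (last a a<ℓ))

      occursAt-τ⇒ : OccursAt τ w i t → Q (window W i) × W (i + j) < W t
      occursAt-τ⇒ occ = occursAt⇒window occ ,
        subst₂ _<_ (letter-< j<ℓ) letter-ℓ (sameOrder⇒< (occ j ℓ (<1+ℓ j<ℓ) (n<1+n ℓ)) T-peak<last)

      occursAt-τ⇐ : Q (window W i) → W (i + j) < W t → OccursAt τ w i t
      occursAt-τ⇐ q peak<t = window⇒occursAt q λ a a<ℓ →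
        sameOrder-< (≤-<-trans (≤peak {window W i} (Q-peak q) a<ℓ) peak<t) (≤-<-trans (≤peak {T} T-below-peak a<ℓ) T-peak<last)

      occursAt-ρ⇒ : OccursAt ρ w i t → Q (window W i) × (∀ {a} → a < ℓ → a ≢ j → W (i + a) < W t) × W t < W (i + j)
      occursAt-ρ⇒ occ = q , side<t , t<peak
        where
        iso : OrderIsoUpTo ℓ (window W i) S
        iso = occursAt⇒window occ
        q : Q (window W i)
        q = orderIsoUpTo-repeak j iso (λ _ _ _ → refl) (λ _ a<ℓ a≢j → S-other a<ℓ a≢j)
              (λ a<ℓ a≢j → sameOrder⇒< (iso _ j a<ℓ j<ℓ) (S-below-peak a<ℓ a≢j)) T-below-peak
        side<t : ∀ {a} → a < ℓ → a ≢ j → W (i + a) < W t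
        side<t a<ℓ a≢j = subst₂ _<_ (letter-< a<ℓ) letter-ℓ
          (sameOrder⇒< (occ _ ℓ (<1+ℓ a<ℓ) (n<1+n ℓ)) (subst₂ _<_ (sym (S-other a<ℓ a≢j)) (sym S-last) (T-below-peak a<ℓ a≢j)))
        t<peak : W t < W (i + j)
        t<peak = subst₂ _<_ letter-ℓ (letter-< j<ℓ)
          (sameOrder⇒< (occ ℓ j (n<1+n ℓ) (<1+ℓ j<ℓ)) (subst₂ _<_ (sym S-last) (sym S-peak) T-peak<last))

      occursAt-ρ⇐ : Q (window W i) → (∀ {a} → a < ℓ → a ≢ j → W (i + a) < W t) → W t < W (i + j) → OccursAt ρ w i t
      occursAt-ρ⇐ q side<t t<peak = window⇒occursAt iso last
        where
        iso : OrderIsoUpTo ℓ (window W i) S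
        iso = orderIsoUpTo-repeak j q (λ _ _ _ → refl) (λ _ a<ℓ a≢j → sym (S-other a<ℓ a≢j)) (Q-peak q) S-below-peak
        last : ∀ a → a < ℓ → SameOrder (W (i + a)) (W t) (S a) (S ℓ)
        last a a<ℓ with a ≟ j
        ... | yes refl = sameOrder-> t<peak (subst₂ _<_ (sym S-last) (sym S-peak) T-peak<last)
        ... | no a≢j = sameOrder-< (side<t a<ℓ a≢j) (subst₂ _<_ (sym (S-other a<ℓ a≢j)) (sym S-last) (T-below-peak a<ℓ a≢j))

    module _ {k n : ℕ} (w : Vec (Fin k) n) where

      avoids-τ⇒ : Avoids τ w → TailsUnderPeak n (letters w)
      avoids-τ⇒ avoids i t i+ℓ≤t t<n q with letters w t ≤? letters w (i + j)
      ... | yes t≤peak = t≤peak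
      ... | no t≰peak = ⊥-elim (avoids (occursAt⇒contains τ w i+ℓ≤t t<n (occursAt-τ⇐ w q (≰⇒> t≰peak))))

      avoids-τ⇐ : TailsUnderPeak n (letters w) → Avoids τ w
      avoids-τ⇐ tails contains with contains⇒occursAt τ w contains
      ... | i , t , i+ℓ≤t , t<n , occ = <⇒≱ (proj₂ (occursAt-τ⇒ w occ)) (tails i t i+ℓ≤t t<n (proj₁ (occursAt-τ⇒ w occ)))

      avoids-ρ⇒ : Avoids ρ w → TailsOffGap n (letters w)
      avoids-ρ⇒ avoids i t i+ℓ≤t t<n q with letters w (i + j) ≤? letters w t
      ... | yes peak≤t = inj₂ peak≤t
      ... | no peak≰t with letters w t ≤? sideMax (window (letters w) i)
      ...   | yes t≤side = inj₁ (≤sideMax⇒underSide t≤side)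
      ...   | no t≰side = ⊥-elim (avoids (occursAt⇒contains ρ w i+ℓ≤t t<n (occursAt-ρ⇐ w q side<t (≰⇒> peak≰t))))
        where
        side<t : ∀ {a} → a < ℓ → a ≢ j → letters w (i + a) < letters w t
        side<t a<ℓ a≢j = ≤-<-trans (sideMax-ub (window (letters w) i) a<ℓ a≢j) (≰⇒> t≰side)

      avoids-ρ⇐ : TailsOffGap n (letters w) → Avoids ρ w
      avoids-ρ⇐ tails contains with contains⇒occursAt ρ w contains
      ... | i , t , i+ℓ≤t , t<n , occ with occursAt-ρ⇒ w occ
      ...   | q , side<t , t<peak with tails i t i+ℓ≤t t<n q
      ...     | inj₁ (r , r<ℓ , r≢j , t≤side) = <⇒≱ (side<t r<ℓ r≢j) t≤side
      ...     | inj₂ peak≤t = <⇒≱ t<peak peak≤t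

      avoids-τ? : Dec (Avoids τ w)
      avoids-τ? = map′ avoids-τ⇐ avoids-τ⇒ (tailsUnderPeak? n (letters w))

    module _ {k' n : ℕ} where

      φ-word : Vec (Fin (suc k')) n → Vec (Fin (suc k')) n
      φ-word w = fromLetters (φ n (suc k') n (letters w)) n

      ψ-word : Vec (Fin (suc k')) n → Vec (Fin (suc k')) n
      ψ-word v = fromLetters (ψ n (suc k') n (letters v)) n

      module _ (w : Vec (Fin (suc k')) n) (avoids : Avoids τ w) where

        φ-spec : Below (suc k') n (φ n (suc k') n (letters w)) × TailsOffGap n (φ n (suc k') n (letters w)) ×
                 ψ n (suc k') n (φ n (suc k') n (letters w)) ≗[ n ] letters w
        φ-spec = φ-correct n (suc k') n (letters w) ≤-refl (λ _ → letters-< w) (avoids-τ⇒ w avoids)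

        letters-φ-word : letters (φ-word w) ≗[ n ] φ n (suc k') n (letters w)
        letters-φ-word t t<n = letters-fromLetters _ n t<n (proj₁ φ-spec t t<n)

        φ-word-avoids : Avoids ρ (φ-word w)
        φ-word-avoids = avoids-ρ⇐ (φ-word w) (tailsOffGap-cong (≗[]-sym letters-φ-word) (proj₁ (proj₂ φ-spec)))

        ψ∘φ-word : ψ-word (φ-word w) ≡ w
        ψ∘φ-word = fromLetters-letters _ n w λ t t<n →
          trans (ψ-cong n (suc k') n letters-φ-word t t<n) (proj₂ (proj₂ φ-spec) t t<n)

      module _ (v : Vec (Fin (suc k')) n) (avoids : Avoids ρ v) where

        ψ-spec : Below (suc k') n (ψ n (suc k') n (letters v)) × TailsUnderPeak n (ψ n (suc k') n (letters v)) ×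
                 φ n (suc k') n (ψ n (suc k') n (letters v)) ≗[ n ] letters v
        ψ-spec = ψ-correct n (suc k') n (letters v) ≤-refl (λ _ → letters-< v) (avoids-ρ⇒ v avoids)

        letters-ψ-word : letters (ψ-word v) ≗[ n ] ψ n (suc k') n (letters v)
        letters-ψ-word t t<n = letters-fromLetters _ n t<n (proj₁ ψ-spec t t<n)

        ψ-word-avoids : Avoids τ (ψ-word v)
        ψ-word-avoids = avoids-τ⇐ (ψ-word v) (tailsUnderPeak-cong (≗[]-sym letters-ψ-word) (proj₁ (proj₂ ψ-spec)))

        φ∘ψ-word : φ-word (ψ-word v) ≡ v
        φ∘ψ-word = fromLetters-letters _ n v λ t t<n →
          trans (φ-cong n (suc k') n letters-ψ-word t t<n) (proj₂ (proj₂ ψ-spec) t t<n)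

    φ-word-head : ∀ {k' m} (w : Vec (Fin (suc k')) (suc m)) → head (φ-word w) ≡ head w
    φ-word-head {k'} {m} w =
      head-fromLetters w (φ (suc m) (suc k') (suc m) (letters w)) (φ-head (suc m) (suc k') (suc m) (letters w))

    ψ-word-head : ∀ {k' m} (v : Vec (Fin (suc k')) (suc m)) → head (ψ-word v) ≡ head v
    ψ-word-head {k'} {m} v =
      head-fromLetters v (ψ (suc m) (suc k') (suc m) (letters v)) (ψ-head (suc m) (suc k') (suc m) (letters v))

    wilf-equivalent : WilfEquiv τ ρ
    wilf-equivalent n (suc k') _ with countIs-filter (avoids-τ? {suc k'} {n})
    ... | c , count = c , count ,
      countIs-transport φ-word ψ-word (λ {w} → φ-word-avoids w) (λ {v} → ψ-word-avoids v)
                                      (λ {w} → ψ∘φ-word w) (λ {v} → φ∘ψ-word v) count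

    first-letter-equivalent : (n k : ℕ) → 1 ≤ k → (a : Fin k) →
                              ∃ λ c → aCountFirst τ n k a c × aCountFirst ρ n k a c
    first-letter-equivalent n (suc k') _ a with countIs-filter (λ w → avoids-τ? {suc k'} {suc n} w ×-dec (head w F.≟ a))
    ... | c , count = c , count , countIs-transport φ-word ψ-word
      (λ {w} (avoids , head≡a) → φ-word-avoids w avoids , trans (φ-word-head w) head≡a)
      (λ {v} (avoids , head≡a) → ψ-word-avoids v avoids , trans (ψ-word-head v) head≡a)
      (λ {w} (avoids , _) → ψ∘φ-word w avoids) (λ {v} (avoids , _) → φ∘ψ-word v avoids) count

peak-decomposition : ∀ ℓ J → 2 ≤ suc J → suc J ≤ ℓ ∸ 1 →
                     ∃ λ j' → ∃ λ e → J ≡ suc j' × ℓ ≡ suc (suc j') + suc e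
peak-decomposition (suc ℓ') zero (s≤s ()) _
peak-decomposition (suc ℓ') (suc j') _ 2+j'≤ℓ' = j' , ℓ' ∸ suc (suc j') , refl ,
  cong suc (trans (sym (m+[n∸m]≡n 2+j'≤ℓ')) (sym (+-suc (suc j') (ℓ' ∸ suc (suc j')))))

theorem2p2 : (ℓ p : ℕ) → 3 ≤ ℓ → (τ : Fin (suc ℓ) → ℕ) → IsPattern p τ →
    (jp : Fin (suc ℓ)) → PeakShape τ jp →
    WilfEquiv τ (swapLast jp τ) ×
    ((n k : ℕ) → 1 ≤ k → (a : Fin k) →
      ∃ λ c → aCountFirst τ n k a c × aCountFirst (swapLast jp τ) n k a c)
-- Only relative order matters.
theorem2p2 ℓ _ _ τ _ jp shape@(2≤j , j≤ℓ-1 , _) with peak-decomposition ℓ (toℕ jp) 2≤j j≤ℓ-1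
... | j' , e , jp≡j , refl = wilf-equivalent τ jp jp≡j shape , first-letter-equivalent τ jp jp≡j shape
  where open PeakPattern j' e
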